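{- Let $n\ge1$, let $W=\mathfrak S_n$ be the symmetric group (the Coxeter group of type $A_{n-1}$, whose reflections are the transpositions), and fix the Coxeter element $c=(1\,2\,\cdots\,n)$. Then: (1) $c^{ -1}$ has $n-1$ antiexceedances; (2) every element of $\mathfrak S_n$ other than $c^{ -1}$ has at most $n-2$ antiexceedances; (3) for every $w\in\mathfrak S_n$, $\mathrm{aexc}(\mathsf{Pop}_T(w,c))=\mathrm{aexc}(w)-\mathrm{cyc}_{>1}(\pi_T(w,c))$.
   Context: An antiexceedance of $w\in\mathfrak S_n$ is an $i\in[n]$ with $i<w^{ -1}(i)$; $\mathrm{aexc}(w)$ is the number of antiexceedances. $\mathrm{cyc}_{>1}(w)$ is the number of non-singleton cycles of $w$. $T$ is the set of transpositions; $\ell_T(w)$ is the minimal number of transpositions with product $w$; absolute order $v\le_T w$ iff $\ell_T(wv^{ -1})=\ell_T(w)-\ell_T(v)$. $\mathrm{NC}(\mathfrak S_n,c)=[e,c]$ in absolute order, a lattice with join $\bigvee$. $\pi_T(w,c)=\bigvee_{t\in T,\ t\le_T w}t$ (join in $\mathrm{NC}(\mathfrak S_n,c)$, empty join $=e$) and $\mathsf{Pop}_T(w,c)=w\,\pi_T(w,c)^{ -1}$. -}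

module Defs where

open import Data.Nat using (ℕ; zero; suc; _+_; _≤_; _<_; NonZero; _%_; _≤?_)
open import Data.Fin using (Fin; toℕ) renaming (_<?_ to _<ᶠ?_; _≤?_ to _≤ᶠ?_)
open import Data.Fin.Permutation using (Permutation′; _⟨$⟩ʳ_; _⟨$⟩ˡ_; _∘ₚ_; flip; transpose; _≈_)
  renaming (id to idₚ)
open import Data.List using (List; []; _∷_; length; filter; upTo; foldr; allFin)
open import Data.List.Relation.Unary.All using (All; all?)
open import Data.Product using (Σ; ∃; _×_; _,_)
open import Relation.Binary.PropositionalEquality using (_≡_; _≢_)
open import Relation.Nullary using (¬_; Dec)
open import Relation.Nullary.Decidable using (_×-dec_; ¬?)
open import Data.Fin using (_≟_)

Perm : ℕ → Set
Perm = Permutation′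

private variable n : ℕ

-- Composition as functions: (w · v)(i) = w (v i).
infixl 7 _·_
_·_ : Perm n → Perm n → Perm n
w · v = v ∘ₚ w

_⁻¹ : Perm n → Perm n
w ⁻¹ = flip w

e : Perm n
e = idₚ

_^_ : Perm n → ℕ → Perm n
w ^ zero = e
w ^ suc k = w · (w ^ k)

IsTransposition : Perm n → Set
IsTransposition {n} t = Σ (Fin n) λ i → Σ (Fin n) λ j → (i ≢ j) × (t ≈ transpose i j)

prodT : List (Fin n × Fin n) → Perm n
prodT = foldr (λ { (i , j) acc → transpose i j · acc }) e

IsProdOfT : ℕ → Perm n → Set
IsProdOfT {n} k w = Σ (List (Fin n × Fin n)) λ ts →
  (length ts ≡ k) × All (λ { (i , j) → i ≢ j }) ts × (prodT ts ≈ w)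

HasLengthT : Perm n → ℕ → Set
HasLengthT w k = IsProdOfT k w × (∀ m → IsProdOfT m w → k ≤ m)

-- Absolute order: v ≤_T w iff ℓ_T(w v⁻¹) = ℓ_T(w) − ℓ_T(v)
-- (written additively: ℓ_T(w v⁻¹) + ℓ_T(v) = ℓ_T(w)).
_≤T_ : Perm n → Perm n → Set
v ≤T w = Σ ℕ λ a → Σ ℕ λ b → Σ ℕ λ d →
  HasLengthT (w · v ⁻¹) a × HasLengthT w b × HasLengthT v d × (a + d ≡ b)

-- c is the Coxeter element (1 2 ⋯ n), i.e. c(i) = i+1 mod n (0-indexed).
IsCoxeterElement : (n : ℕ) → .{{NonZero n}} → Perm n → Set
IsCoxeterElement n c = ∀ (i : Fin n) → toℕ (c ⟨$⟩ʳ i) ≡ suc (toℕ i) % n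

InNC : Perm n → Perm n → Set
InNC c u = (e ≤T u) × (u ≤T c)

IsJoinNC : Perm n → (Perm n → Set) → Perm n → Set
IsJoinNC c S j = InNC c j × (∀ s → S s → s ≤T j)
  × (∀ u → InNC c u → (∀ s → S s → s ≤T u) → j ≤T u)

IsPiT : Perm n → Perm n → Perm n → Set
IsPiT c w p = IsJoinNC c (λ t → IsTransposition t × (t ≤T w)) p

PopT : Perm n → Perm n → Perm n
PopT w p = w · p ⁻¹

count : {P : Fin n → Set} → (∀ i → Dec (P i)) → ℕ
count {n} P? = length (filter P? (allFin n))

aexc : Perm n → ℕ
aexc w = count (λ i → i <ᶠ? (w ⁻¹) ⟨$⟩ʳ i)

-- i is the least element of its cycle under w: i ≤ w^k(i) for all k < n
-- (the cycle of i is {w^k(i) : k < n}, since cycles have length ≤ n).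
IsCycleMin? : (w : Perm n) → (i : Fin n) → Dec (All (λ k → toℕ i ≤ toℕ ((w ^ k) ⟨$⟩ʳ i)) (upTo n))
IsCycleMin? {n} w i = all? (λ k → toℕ i ≤? toℕ ((w ^ k) ⟨$⟩ʳ i)) (upTo n)

cycGt1 : Perm n → ℕ
cycGt1 w = count (λ i → IsCycleMin? w i ×-dec ¬? (w ⟨$⟩ʳ i ≟ i))

-- ℓ_T(u) is n minus the number of cycles of u, so a transposition (a b) lies below w in
-- absolute order exactly when a and b share a cycle of w. Hence π = π_T(w, c) has j and w(j) on
-- one cycle and fixes every fixed point of w. The elements of [e, c] arise from c by splitting
-- cycles, which keeps every cycle increasing in the cyclic order 0 < 1 < ⋯ < n − 1 < 0; so each
-- nontrivial cycle of π climbs from its least element and drops back exactly once. Counting the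
-- antiexceedances of u as the j with u(j) < j, every j satisfies
-- [w(j) < π(j)] + [π(j) < j] = [w(j) < j], and the second brackets count the nontrivial cycles.
-- For (1) and (2): the largest point is never an antiexceedance, and all others are exactly when w⁻¹ = c.

module Submission where

open import Defs
open import Data.Nat as ℕ
  using (ℕ; zero; suc; _+_; _*_; _∸_; _≤_; _<_; z≤n; s≤s; NonZero; _%_; _/_)
import Data.Nat.Properties as ℕ
open import Data.Nat.DivMod using (m%n<n; m%n≤m; m≡m%n+[m/n]*n; n%n≡0; m<n⇒m%n≡m)
open import Algebra.Properties.CommutativeMonoid.Sum ℕ.+-0-commutativeMonoid
  using (sum; sum-cong-≗; sum-replicate-zero; ∑-distrib-+; ∑-permute)
open import Algebra.Properties.CommutativeSemigroup ℕ.+-commutativeSemigroup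
  using (x∙yz≈y∙xz; x∙yz≈yx∙z; xy∙z≈xz∙y; xy∙z≈y∙xz)
open import Data.Empty using (⊥-elim)
open import Data.Fin as Fin using (Fin; toℕ; _≟_; fromℕ<) renaming (_<?_ to _<ᶠ?_)
open import Data.Fin.Permutation using (_⟨$⟩ʳ_; _⟨$⟩ˡ_; inverseˡ; inverseʳ; transpose; _≈_)
open import Data.Fin.Properties
  using (suc-injective; toℕ-injective; toℕ<n; toℕ-fromℕ<; toℕ-fromℕ; pigeonhole; any?; all?)
open import Data.List using (List; []; _∷_; _++_; length; filter; tabulate; upTo)
open import Data.List.Properties using (length-++)
open import Data.List.Relation.Unary.All using (All; []; _∷_)
open import Data.List.Relation.Unary.All.Properties using (++⁺; applyUpTo⁺₁; applyUpTo⁻)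
open import Data.Product using (∃; _×_; _,_; proj₁; proj₂)
open import Data.Sum using (_⊎_; inj₁; inj₂)
open import Relation.Binary using (tri<; tri≈; tri>)
open import Relation.Binary.PropositionalEquality
open import Relation.Nullary using (¬_; Dec; yes; no)
open import Relation.Nullary.Decidable using (¬?; _→-dec_; _×-dec_)

private variable n : ℕ

-- Cycles of a permutation

⟨$⟩ʳ-injective : (u : Perm n) {x y : Fin n} → u ⟨$⟩ʳ x ≡ u ⟨$⟩ʳ y → x ≡ y
⟨$⟩ʳ-injective u {x} {y} eq = trans (sym (inverseˡ u)) (trans (cong (u ⟨$⟩ˡ_) eq) (inverseˡ u))

^-+ : (u : Perm n) (k l : ℕ) (x : Fin n) → (u ^ (k + l)) ⟨$⟩ʳ x ≡ (u ^ k) ⟨$⟩ʳ ((u ^ l) ⟨$⟩ʳ x)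
^-+ u zero    l x = refl
^-+ u (suc k) l x = cong (u ⟨$⟩ʳ_) (^-+ u k l x)

^-suc : (u : Perm n) (k : ℕ) (x : Fin n) → (u ^ suc k) ⟨$⟩ʳ x ≡ (u ^ k) ⟨$⟩ʳ (u ⟨$⟩ʳ x)
^-suc u k x = trans (cong (λ m → (u ^ m) ⟨$⟩ʳ x) (ℕ.+-comm 1 k)) (^-+ u k 1 x)

^-cong : {u v : Perm n} → u ≈ v → ∀ k → (u ^ k) ≈ (v ^ k)
^-cong         u≈v zero    x = refl
^-cong {u = u} u≈v (suc k) x = trans (cong (u ⟨$⟩ʳ_) (^-cong u≈v k x)) (u≈v _)

^-fixed : (u : Perm n) {x : Fin n} → u ⟨$⟩ʳ x ≡ x → ∀ k → (u ^ k) ⟨$⟩ʳ x ≡ x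
^-fixed u ux zero    = refl
^-fixed u ux (suc k) = trans (cong (u ⟨$⟩ʳ_) (^-fixed u ux k)) ux

^-periodic : (u : Perm n) (m : ℕ) (x : Fin n) → (u ^ m) ⟨$⟩ʳ x ≡ x → ∀ q → (u ^ (q * m)) ⟨$⟩ʳ x ≡ x
^-periodic u m x per zero    = refl
^-periodic u m x per (suc q) =
  trans (^-+ u m (q * m) x) (trans (cong ((u ^ m) ⟨$⟩ʳ_) (^-periodic u m x per q)) per)

-- By the pigeonhole principle two of x, u x, …, uⁿ x coincide.
^-period : (u : Perm n) (x : Fin n) → ∃ λ m → 0 < m × m ≤ n × (u ^ m) ⟨$⟩ʳ x ≡ x
^-period {n} u x with pigeonhole (ℕ.n<1+n n) (λ (k : Fin (suc n)) → (u ^ toℕ k) ⟨$⟩ʳ x)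
... | i , j , i<j , eq = toℕ j ∸ toℕ i , ℕ.m<n⇒0<n∸m i<j ,
      ℕ.≤-trans (ℕ.m∸n≤m (toℕ j) (toℕ i)) (ℕ.≤-pred (toℕ<n j)) ,
      ⟨$⟩ʳ-injective (u ^ toℕ i) (begin
        (u ^ toℕ i) ⟨$⟩ʳ ((u ^ (toℕ j ∸ toℕ i)) ⟨$⟩ʳ x)
          ≡⟨ sym (^-+ u (toℕ i) _ x) ⟩
        (u ^ (toℕ i + (toℕ j ∸ toℕ i))) ⟨$⟩ʳ x
          ≡⟨ cong (λ m → (u ^ m) ⟨$⟩ʳ x) (ℕ.m+[n∸m]≡n (ℕ.<⇒≤ i<j)) ⟩
        (u ^ toℕ j) ⟨$⟩ʳ x
          ≡⟨ sym eq ⟩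
        (u ^ toℕ i) ⟨$⟩ʳ x ∎)
  where open ≡-Reasoning

∃-least : {P : Fin n → Set} → (∀ x → Dec (P x)) → {x₀ : Fin n} → P x₀ →
  ∃ λ m → P m × (∀ y → P y → toℕ m ≤ toℕ y)
∃-least {suc n} P? {x₀} p₀ with P? Fin.zero | x₀
... | yes p | _        = Fin.zero , p , λ _ _ → z≤n
... | no ¬p | Fin.zero = ⊥-elim (¬p p₀)
... | no ¬p | Fin.suc x₁ with ∃-least (λ x → P? (Fin.suc x)) {x₁} p₀
...   | m , pm , least = Fin.suc m , pm , λ { Fin.zero py → ⊥-elim (¬p py) ; (Fin.suc y) py → s≤s (least y py) }

SameCycle : Perm n → Fin n → Fin n → Set
SameCycle u x y = ∃ λ k → (u ^ k) ⟨$⟩ʳ x ≡ y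

sameCycle-refl : (u : Perm n) (x : Fin n) → SameCycle u x x
sameCycle-refl u x = 0 , refl

sameCycle-step : (u : Perm n) (x : Fin n) → SameCycle u x (u ⟨$⟩ʳ x)
sameCycle-step u x = 1 , refl

sameCycle-trans : (u : Perm n) {x y z : Fin n} → SameCycle u x y → SameCycle u y z → SameCycle u x z
sameCycle-trans u {x} (k , refl) (l , refl) = l + k , ^-+ u l k x

sameCycle-sym : (u : Perm n) {x y : Fin n} → SameCycle u x y → SameCycle u y x
sameCycle-sym u {x} (k , refl) with ^-period u x
... | suc m , _ , _ , per = k * m , (begin
  (u ^ (k * m)) ⟨$⟩ʳ ((u ^ k) ⟨$⟩ʳ x)
    ≡⟨ sym (^-+ u (k * m) k x) ⟩
  (u ^ (k * m + k)) ⟨$⟩ʳ x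
    ≡⟨ cong (λ l → (u ^ l) ⟨$⟩ʳ x) (trans (ℕ.+-comm (k * m) k) (sym (ℕ.*-suc k m))) ⟩
  (u ^ (k * suc m)) ⟨$⟩ʳ x
    ≡⟨ ^-periodic u (suc m) x per k ⟩
  x ∎)
  where open ≡-Reasoning

sameCycle-bounded : (u : Perm n) {x y : Fin n} → SameCycle u x y → ∃ λ k → k < n × (u ^ k) ⟨$⟩ʳ x ≡ y
sameCycle-bounded u {x} (k , refl) with ^-period u x
... | suc m , _ , m≤n , per = k % suc m , ℕ.<-≤-trans (m%n<n k (suc m)) m≤n , (begin
  (u ^ (k % suc m)) ⟨$⟩ʳ x
    ≡⟨ cong ((u ^ (k % suc m)) ⟨$⟩ʳ_) (sym (^-periodic u (suc m) x per (k / suc m))) ⟩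
  (u ^ (k % suc m)) ⟨$⟩ʳ ((u ^ (k / suc m * suc m)) ⟨$⟩ʳ x)
    ≡⟨ sym (^-+ u (k % suc m) _ x) ⟩
  (u ^ (k % suc m + k / suc m * suc m)) ⟨$⟩ʳ x
    ≡⟨ cong (λ l → (u ^ l) ⟨$⟩ʳ x) (sym (m≡m%n+[m/n]*n k (suc m))) ⟩
  (u ^ k) ⟨$⟩ʳ x ∎)
  where open ≡-Reasoning

sameCycle? : (u : Perm n) (x y : Fin n) → Dec (SameCycle u x y)
sameCycle? {n} u x y with any? (λ (k : Fin n) → (u ^ toℕ k) ⟨$⟩ʳ x ≟ y)
... | yes (k , eq) = yes (toℕ k , eq)
... | no none      = no λ xy → let (k , k<n , eq) = sameCycle-bounded u xy in
  none (fromℕ< k<n , trans (cong (λ l → (u ^ l) ⟨$⟩ʳ x) (toℕ-fromℕ< k<n)) eq)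

sameCycle-first-arrival : (u : Perm n) {a b : Fin n} → SameCycle u a b →
  ∃ λ K → (u ^ K) ⟨$⟩ʳ a ≡ b × (∀ i → i < K → (u ^ i) ⟨$⟩ʳ a ≢ b)
sameCycle-first-arrival {n} u {a} {b} a~b with sameCycle-bounded u a~b
... | k , k<n , uᵏa≡b with ∃-least (λ l → (u ^ toℕ l) ⟨$⟩ʳ a ≟ b) {fromℕ< k<n}
                                 (trans (cong (λ l → (u ^ l) ⟨$⟩ʳ a) (toℕ-fromℕ< k<n)) uᵏa≡b)
...   | K , uᴷa≡b , least = toℕ K , uᴷa≡b , not-before
  where
  not-before : ∀ i → i < toℕ K → (u ^ i) ⟨$⟩ʳ a ≢ b
  not-before i i<K uⁱa≡b = ℕ.<⇒≱ i<K (subst (toℕ K ≤_) (toℕ-fromℕ< i<n)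
      (least (fromℕ< i<n) (trans (cong (λ l → (u ^ l) ⟨$⟩ʳ a) (toℕ-fromℕ< i<n)) uⁱa≡b)))
    where
    i<n : i < n
    i<n = ℕ.<-trans i<K (toℕ<n K)

sameCycle-fixed : (u : Perm n) {x y : Fin n} → u ⟨$⟩ʳ x ≡ x → SameCycle u x y → y ≡ x
sameCycle-fixed u ux (k , eq) = trans (sym eq) (^-fixed u ux k)

sameCycle-cong : {u v : Perm n} → u ≈ v → {x y : Fin n} → SameCycle u x y → SameCycle v x y
sameCycle-cong u≈v {x} (k , eq) = k , trans (sym (^-cong u≈v k x)) eq

sameCycle-inverse : (u : Perm n) {x y : Fin n} → SameCycle u x y → SameCycle (u ⁻¹) y x
sameCycle-inverse u {x} (k , refl) = k , undo k
  where
  undo : ∀ k → ((u ⁻¹) ^ k) ⟨$⟩ʳ ((u ^ k) ⟨$⟩ʳ x) ≡ x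
  undo zero    = refl
  undo (suc k) = trans (^-suc (u ⁻¹) k _) (trans (cong (((u ⁻¹) ^ k) ⟨$⟩ʳ_) (inverseˡ u)) (undo k))

-- Transpositions

transpose-matchˡ : (a b : Fin n) → transpose a b ⟨$⟩ʳ a ≡ b
transpose-matchˡ a b with a ≟ a
... | yes _ = refl
... | no a≢a = ⊥-elim (a≢a refl)

transpose-matchʳ : (a b : Fin n) → transpose a b ⟨$⟩ʳ b ≡ a
transpose-matchʳ a b with b ≟ a
... | yes b≡a = b≡a
... | no _ with b ≟ b
...   | yes _ = refl
...   | no b≢b = ⊥-elim (b≢b refl)

transpose-other : (a b : Fin n) {z : Fin n} → z ≢ a → z ≢ b → transpose a b ⟨$⟩ʳ z ≡ z
transpose-other a b {z} z≢a z≢b with z ≟ a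
... | yes z≡a = ⊥-elim (z≢a z≡a)
... | no _ with z ≟ b
...   | yes z≡b = ⊥-elim (z≢b z≡b)
...   | no _ = refl

transpose-involutive : (a b z : Fin n) → transpose a b ⟨$⟩ʳ (transpose a b ⟨$⟩ʳ z) ≡ z
transpose-involutive a b z with z ≟ a
... | yes refl = transpose-matchʳ a b
... | no z≢a with z ≟ b
...   | yes refl = transpose-matchˡ a b
...   | no z≢b = transpose-other a b z≢a z≢b

≡-either : (z a b : Fin n) → z ≡ a ⊎ z ≡ b ⊎ (z ≢ a × z ≢ b)
≡-either z a b with z ≟ a | z ≟ b
... | yes z≡a | _        = inj₁ z≡a
... | no _     | yes z≡b  = inj₂ (inj₁ z≡b)
... | no z≢a   | no z≢b   = inj₂ (inj₂ (z≢a , z≢b))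

transpose-flip : (a b : Fin n) {u v : Perm n} → transpose a b · u ≈ v → transpose a b · v ≈ u
transpose-flip a b {u} uv x = trans (cong (transpose a b ⟨$⟩ʳ_) (sym (uv x))) (transpose-involutive a b (u ⟨$⟩ʳ x))

Joined : Perm n → Fin n → Fin n → Fin n → Fin n → Set
Joined u a b x y = SameCycle u x y ⊎ (SameCycle u x a × SameCycle u y b) ⊎ (SameCycle u x b × SameCycle u y a)

module _ {u v : Perm n} {a b : Fin n} (a≢b : a ≢ b) (uv : transpose a b · u ≈ v) where

  private
    v-step : ∀ x → v ⟨$⟩ʳ x ≡ transpose a b ⟨$⟩ʳ (u ⟨$⟩ʳ x)
    v-step x = sym (uv x)

    -- v follows the u-cycle of c until u would return to c; there v jumps to c̄ instead.
    reach-partner : (c c̄ : Fin n) → transpose a b ⟨$⟩ʳ c ≡ c̄ →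
      (∀ {z} → z ≢ c → z ≢ c̄ → transpose a b ⟨$⟩ʳ z ≡ z) → ¬ SameCycle u c c̄ → SameCycle v c c̄
    reach-partner c c̄ τc τz c≁c̄ with ^-period u c
    ... | suc m , _ , _ , per with agree m
      where
      agree : ∀ i → SameCycle v c c̄ ⊎ (v ^ i) ⟨$⟩ʳ c ≡ (u ^ i) ⟨$⟩ʳ c
      agree zero = inj₂ refl
      agree (suc i) with agree i
      ... | inj₁ reached = inj₁ reached
      ... | inj₂ eq with u ⟨$⟩ʳ ((u ^ i) ⟨$⟩ʳ c) ≟ c
      ...   | yes back = inj₁ (suc i ,
              trans (cong (v ⟨$⟩ʳ_) eq) (trans (v-step _) (trans (cong (transpose a b ⟨$⟩ʳ_) back) τc)))
      ...   | no ¬back = inj₂ (trans (cong (v ⟨$⟩ʳ_) eq) (trans (v-step _) (τz ¬back (λ q → c≁c̄ (suc i , q)))))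
    ... | inj₁ reached = reached
    ... | inj₂ eq = suc m , trans (cong (v ⟨$⟩ʳ_) eq) (trans (v-step _) (trans (cong (transpose a b ⟨$⟩ʳ_) per) τc))

  module _ (a≁b : ¬ SameCycle u a b) where

    private
      v-ab : SameCycle v a b
      v-ab = reach-partner a b (transpose-matchˡ a b) (transpose-other a b) a≁b

      v-ba : SameCycle v b a
      v-ba = reach-partner b a (transpose-matchʳ a b) (λ z≢b z≢a → transpose-other a b z≢a z≢b)
               (λ b~a → a≁b (sameCycle-sym u b~a))

      v-reaches-u-step : ∀ x → SameCycle v x (u ⟨$⟩ʳ x)
      v-reaches-u-step x with u ⟨$⟩ʳ x ≟ a | u ⟨$⟩ʳ x ≟ b
      ... | yes refl | _ = sameCycle-trans v (1 , trans (v-step x) (transpose-matchˡ a b)) v-ba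
      ... | no _ | yes refl = sameCycle-trans v (1 , trans (v-step x) (transpose-matchʳ a b)) v-ab
      ... | no ux≢a | no ux≢b = 1 , trans (v-step x) (transpose-other a b ux≢a ux≢b)

      joined-trans : ∀ {x y z} → Joined u a b x y → Joined u a b y z → Joined u a b x z
      joined-trans (inj₁ xy) (inj₁ yz) = inj₁ (sameCycle-trans u xy yz)
      joined-trans (inj₁ xy) (inj₂ (inj₁ (ya , zb))) = inj₂ (inj₁ (sameCycle-trans u xy ya , zb))
      joined-trans (inj₁ xy) (inj₂ (inj₂ (yb , za))) = inj₂ (inj₂ (sameCycle-trans u xy yb , za))
      joined-trans (inj₂ (inj₁ (xa , yb))) (inj₁ yz) = inj₂ (inj₁ (xa , sameCycle-trans u (sameCycle-sym u yz) yb))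
      joined-trans (inj₂ (inj₁ (xa , _))) (inj₂ (inj₁ (_ , zb))) = inj₂ (inj₁ (xa , zb))
      joined-trans (inj₂ (inj₁ (xa , _))) (inj₂ (inj₂ (_ , za))) = inj₁ (sameCycle-trans u xa (sameCycle-sym u za))
      joined-trans (inj₂ (inj₂ (xb , ya))) (inj₁ yz) = inj₂ (inj₂ (xb , sameCycle-trans u (sameCycle-sym u yz) ya))
      joined-trans (inj₂ (inj₂ (xb , _))) (inj₂ (inj₁ (_ , zb))) = inj₁ (sameCycle-trans u xb (sameCycle-sym u zb))
      joined-trans (inj₂ (inj₂ (xb , _))) (inj₂ (inj₂ (_ , za))) = inj₂ (inj₂ (xb , za))

      joined-v-step : ∀ x → Joined u a b x (v ⟨$⟩ʳ x)
      joined-v-step x with u ⟨$⟩ʳ x ≟ a | u ⟨$⟩ʳ x ≟ b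
      ... | yes refl | _ = inj₂ (inj₁ (sameCycle-step u x ,
              subst (λ z → SameCycle u z b) (sym (trans (v-step x) (transpose-matchˡ a b))) (sameCycle-refl u b)))
      ... | no _ | yes refl = inj₂ (inj₂ (sameCycle-step u x ,
              subst (λ z → SameCycle u z a) (sym (trans (v-step x) (transpose-matchʳ a b))) (sameCycle-refl u a)))
      ... | no ux≢a | no ux≢b = inj₁ (1 , sym (trans (v-step x) (transpose-other a b ux≢a ux≢b)))

    sameCycle-merge⁺ : ∀ {x y} → SameCycle u x y → SameCycle v x y
    sameCycle-merge⁺ {x} (zero , refl) = sameCycle-refl v x
    sameCycle-merge⁺ {x} (suc k , refl) = sameCycle-trans v (sameCycle-merge⁺ (k , refl)) (v-reaches-u-step _)

    joined⇒sameCycle : ∀ {x y} → Joined u a b x y → SameCycle v x y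
    joined⇒sameCycle (inj₁ xy) = sameCycle-merge⁺ xy
    joined⇒sameCycle (inj₂ (inj₁ (xa , yb))) =
      sameCycle-trans v (sameCycle-merge⁺ xa) (sameCycle-trans v v-ab (sameCycle-sym v (sameCycle-merge⁺ yb)))
    joined⇒sameCycle (inj₂ (inj₂ (xb , ya))) =
      sameCycle-trans v (sameCycle-merge⁺ xb) (sameCycle-trans v v-ba (sameCycle-sym v (sameCycle-merge⁺ ya)))

    sameCycle⇒joined : ∀ {x y} → SameCycle v x y → Joined u a b x y
    sameCycle⇒joined {x} (zero , refl) = inj₁ (sameCycle-refl u x)
    sameCycle⇒joined {x} (suc k , refl) = joined-trans (sameCycle⇒joined (k , refl)) (joined-v-step _)

  -- If b = uᴷ a with K least, v maps the arc {uⁱ a : i < K} into itself, and b is not on it.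
  sameCycle-split : SameCycle u a b → ¬ SameCycle v a b
  sameCycle-split a~b (j , vʲa≡b) with sameCycle-first-arrival u a~b
  ... | K , uᴷa≡b , not-before-K = not-before-K (proj₁ (on-arc j)) (proj₁ (proj₂ (on-arc j)))
                                     (trans (proj₂ (proj₂ (on-arc j))) vʲa≡b)
    where
    0<K : 0 < K
    0<K = ℕ.n≢0⇒n>0 λ K≡0 → a≢b (trans (cong (λ l → (u ^ l) ⟨$⟩ʳ a) (sym K≡0)) uᴷa≡b)

    not-back-before-K : ∀ i → i < K → (u ^ suc i) ⟨$⟩ʳ a ≢ a
    not-back-before-K i i<K eq = not-before-K (K ∸ suc i) (ℕ.∸-monoʳ-< (s≤s z≤n) i<K) (begin
      (u ^ (K ∸ suc i)) ⟨$⟩ʳ a                        ≡⟨ cong ((u ^ (K ∸ suc i)) ⟨$⟩ʳ_) (sym eq) ⟩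
      (u ^ (K ∸ suc i)) ⟨$⟩ʳ ((u ^ suc i) ⟨$⟩ʳ a)     ≡⟨ sym (^-+ u (K ∸ suc i) (suc i) a) ⟩
      (u ^ (K ∸ suc i + suc i)) ⟨$⟩ʳ a                ≡⟨ cong (λ l → (u ^ l) ⟨$⟩ʳ a) (ℕ.m∸n+n≡m i<K) ⟩
      (u ^ K) ⟨$⟩ʳ a                                  ≡⟨ uᴷa≡b ⟩
      b                                               ∎)
      where open ≡-Reasoning

    OnArc : Fin n → Set
    OnArc z = ∃ λ i → i < K × (u ^ i) ⟨$⟩ʳ a ≡ z

    v-onArc : ∀ z → OnArc z → OnArc (v ⟨$⟩ʳ z)
    v-onArc _ (i , i<K , refl) with ℕ.m≤n⇒m<n∨m≡n i<K
    ... | inj₂ 1+i≡K = 0 , 0<K , sym (trans (v-step _)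
            (trans (cong (transpose a b ⟨$⟩ʳ_) (trans (cong (λ l → (u ^ l) ⟨$⟩ʳ a) 1+i≡K) uᴷa≡b)) (transpose-matchʳ a b)))
    ... | inj₁ 1+i<K = suc i , 1+i<K , sym (trans (v-step _)
            (transpose-other a b (not-back-before-K i i<K) (not-before-K (suc i) 1+i<K)))

    on-arc : ∀ j → OnArc ((v ^ j) ⟨$⟩ʳ a)
    on-arc zero    = 0 , 0<K , refl
    on-arc (suc j) = v-onArc _ (on-arc j)

sameCycle-avoids-fixed : {w : Perm n} {a b j : Fin n} → a ≢ b → SameCycle w a b → w ⟨$⟩ʳ j ≡ j → a ≢ j
sameCycle-avoids-fixed {w = w} a≢b a~b wj≡j refl = a≢b (sym (sameCycle-fixed w wj≡j a~b))

sameCycle-splitOff : {w p : Perm n} {a b j : Fin n} → j ≢ p ⟨$⟩ʳ j → a ≢ b → w ⟨$⟩ʳ j ≡ j →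
  SameCycle w a b → SameCycle p a b → SameCycle (transpose j (p ⟨$⟩ʳ j) · p) a b
sameCycle-splitOff {n} {w} {p} {a} {b} {j} j≢pj a≢b wj≡j a~ʷb a~ᵖb
  with sameCycle⇒joined {u = u} {p} j≢pj (transpose-flip j pj {p} {u} (λ _ → refl))
         (sameCycle-split {u = p} {u} j≢pj (λ _ → refl) (sameCycle-step p j)) a~ᵖb
  where
  pj : Fin n
  pj = p ⟨$⟩ʳ j
  u : Perm n
  u = transpose j pj · p
... | inj₁ a~ᵘb = a~ᵘb
... | inj₂ (inj₁ (a~ᵘj , _)) = ⊥-elim (sameCycle-avoids-fixed a≢b a~ʷb wj≡j
                                 (sameCycle-fixed _ (transpose-matchʳ j (p ⟨$⟩ʳ j)) (sameCycle-sym _ a~ᵘj)))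
... | inj₂ (inj₂ (_ , b~ᵘj)) = ⊥-elim (sameCycle-avoids-fixed (λ b≡a → a≢b (sym b≡a)) (sameCycle-sym w a~ʷb) wj≡j
                                 (sameCycle-fixed _ (transpose-matchʳ j (p ⟨$⟩ʳ j)) (sameCycle-sym _ b~ᵘj)))

𝟙[_] : {P : Set} → Dec P → ℕ
𝟙[ yes _ ] = 1
𝟙[ no _ ]  = 0

𝟙-yes : {P : Set} (P? : Dec P) → P → 𝟙[ P? ] ≡ 1
𝟙-yes (yes _) _  = refl
𝟙-yes (no ¬p) p  = ⊥-elim (¬p p)

𝟙-no : {P : Set} (P? : Dec P) → ¬ P → 𝟙[ P? ] ≡ 0
𝟙-no (yes p) ¬p = ⊥-elim (¬p p)
𝟙-no (no _)  _  = refl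

𝟙≤1 : {P : Set} (P? : Dec P) → 𝟙[ P? ] ≤ 1
𝟙≤1 (yes _) = s≤s z≤n
𝟙≤1 (no _)  = z≤n

𝟙-cong : {P Q : Set} (P? : Dec P) (Q? : Dec Q) → (P → Q) → (Q → P) → 𝟙[ P? ] ≡ 𝟙[ Q? ]
𝟙-cong (yes _) (yes _) _ _ = refl
𝟙-cong (no _)  (no _)  _ _ = refl
𝟙-cong (yes p) (no ¬q) f _ = ⊥-elim (¬q (f p))
𝟙-cong (no ¬p) (yes q) _ g = ⊥-elim (¬p (g q))

length-filter-tabulate : {A : Set} {P : A → Set} (P? : ∀ a → Dec (P a)) (m : ℕ) (f : Fin m → A) →
  length (filter P? (tabulate f)) ≡ sum (λ i → 𝟙[ P? (f i) ])
length-filter-tabulate P? zero    f = refl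
length-filter-tabulate P? (suc m) f with P? (f Fin.zero)
... | yes _ = cong suc (length-filter-tabulate P? m (λ i → f (Fin.suc i)))
... | no _  = length-filter-tabulate P? m (λ i → f (Fin.suc i))

count≡sum : {P : Fin n → Set} (P? : ∀ i → Dec (P i)) → count P? ≡ sum (λ i → 𝟙[ P? i ])
count≡sum {n} P? = length-filter-tabulate P? n (λ i → i)

sum-mono-≤ : {f g : Fin n → ℕ} → (∀ i → f i ≤ g i) → sum f ≤ sum g
sum-mono-≤ {zero}  f≤g = z≤n
sum-mono-≤ {suc n} f≤g = ℕ.+-mono-≤ (f≤g Fin.zero) (sum-mono-≤ (λ i → f≤g (Fin.suc i)))

sum-const-1 : (n : ℕ) → sum {n} (λ _ → 1) ≡ n
sum-const-1 zero    = refl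
sum-const-1 (suc n) = cong suc (sum-const-1 n)

sum-𝟙-≟ : (m : Fin n) → sum (λ i → 𝟙[ i ≟ m ]) ≡ 1
sum-𝟙-≟ {suc n} Fin.zero = cong suc (sum-replicate-zero n)
sum-𝟙-≟ {suc n} (Fin.suc m) = trans
  (sum-cong-≗ {x = λ i → 𝟙[ Fin.suc i ≟ Fin.suc m ]} λ i →
     𝟙-cong (Fin.suc i ≟ Fin.suc m) (i ≟ m) suc-injective (cong Fin.suc))
  (sum-𝟙-≟ m)

sum-bits+2≤ : {f : Fin n → ℕ} → (∀ i → f i ≤ 1) →
  {M M′ : Fin n} → M ≢ M′ → f M ≡ 0 → f M′ ≡ 0 → sum f + 2 ≤ n
sum-bits+2≤ {n} {f} f≤1 {M} {M′} M≢M′ fM≡0 fM′≡0 = begin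
  sum f + 2
    ≡⟨ cong₂ (λ k l → sum f + (k + l)) (sym (sum-𝟙-≟ M)) (sym (sum-𝟙-≟ M′)) ⟩
  sum f + (sum (λ i → 𝟙[ i ≟ M ]) + sum (λ i → 𝟙[ i ≟ M′ ]))
    ≡⟨ cong (sum f +_) (sym (∑-distrib-+ (λ i → 𝟙[ i ≟ M ]) _)) ⟩
  sum f + sum (λ i → 𝟙[ i ≟ M ] + 𝟙[ i ≟ M′ ])
    ≡⟨ sym (∑-distrib-+ f _) ⟩
  sum (λ i → f i + (𝟙[ i ≟ M ] + 𝟙[ i ≟ M′ ]))
    ≤⟨ sum-mono-≤ pointwise ⟩
  sum {n} (λ _ → 1)
    ≡⟨ sum-const-1 n ⟩
  n ∎
  where
  open ℕ.≤-Reasoning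
  pointwise : ∀ i → f i + (𝟙[ i ≟ M ] + 𝟙[ i ≟ M′ ]) ≤ 1
  pointwise i with i ≟ M | i ≟ M′
  ... | yes refl | yes refl = ⊥-elim (M≢M′ refl)
  ... | yes refl | no _     = ℕ.≤-reflexive (cong (_+ 1) fM≡0)
  ... | no _     | yes refl = ℕ.≤-reflexive (cong (_+ 1) fM′≡0)
  ... | no _     | no _     = ℕ.≤-trans (ℕ.≤-reflexive (ℕ.+-identityʳ (f i))) (f≤1 i)

-- Reflection length

IsCycleLeast : Perm n → Fin n → Set
IsCycleLeast u x = ∀ y → SameCycle u x y → toℕ x ≤ toℕ y

isCycleLeast? : (u : Perm n) (x : Fin n) → Dec (IsCycleLeast u x)
isCycleLeast? u x = all? (λ y → sameCycle? u x y →-dec (toℕ x ℕ.≤? toℕ y))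

-- cycGt1 recognises the least point of a cycle through the powers uᵏ i with k < n.
PowersAbove : Perm n → Fin n → Set
PowersAbove {n} u i = All (λ k → toℕ i ≤ toℕ ((u ^ k) ⟨$⟩ʳ i)) (upTo n)

powersAbove⇒cycleLeast : (u : Perm n) (i : Fin n) → PowersAbove u i → IsCycleLeast u i
powersAbove⇒cycleLeast {n} u i above y i~y with sameCycle-bounded u i~y
... | k , k<n , uᵏi≡y = subst (λ z → toℕ i ≤ toℕ z) uᵏi≡y (applyUpTo⁻ (λ k → k) n above k<n)

cycleLeast⇒powersAbove : (u : Perm n) (i : Fin n) → IsCycleLeast u i → PowersAbove u i
cycleLeast⇒powersAbove {n} u i least = applyUpTo⁺₁ (λ k → k) n (λ {k} _ → least _ (k , refl))

-- The number of points that are not least in their cycle: n minus the number of cycles of u.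
ℓ : Perm n → ℕ
ℓ u = sum (λ x → 𝟙[ ¬? (isCycleLeast? u x) ])

cycleLeast-unique : (u : Perm n) {x m : Fin n} → SameCycle u x m → IsCycleLeast u x → IsCycleLeast u m → x ≡ m
cycleLeast-unique u x~m x-least m-least =
  toℕ-injective (ℕ.≤-antisym (x-least _ x~m) (m-least _ (sameCycle-sym u x~m)))

cycleLeast : (u : Perm n) (a : Fin n) → ∃ λ m → SameCycle u a m × IsCycleLeast u m
cycleLeast u a with ∃-least (sameCycle? u a) (sameCycle-refl u a)
... | m , a~m , least = m , a~m , λ y m~y → least y (sameCycle-trans u a~m m~y)

joined-swap : {u : Perm n} {a b x y : Fin n} → Joined u a b x y → Joined u b a x y
joined-swap (inj₁ xy)        = inj₁ xy
joined-swap (inj₂ (inj₁ xy)) = inj₂ (inj₂ xy)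
joined-swap (inj₂ (inj₂ xy)) = inj₂ (inj₁ xy)

module _ {u v : Perm n} {a b : Fin n}
  (to-joined : ∀ {x y} → SameCycle v x y → Joined u a b x y)
  (from-joined : ∀ {x y} → Joined u a b x y → SameCycle v x y) where

  -- Joining the cycles of a and b, the larger of their two least elements ceases to be least.
  ℓ-join-ordered : {ma mb : Fin n} → SameCycle u a ma → IsCycleLeast u ma → SameCycle u b mb → IsCycleLeast u mb →
    toℕ ma < toℕ mb → ℓ v ≡ ℓ u + 1
  ℓ-join-ordered {ma} {mb} a~ma ma-least b~mb mb-least ma<mb = begin
    ℓ v
      ≡⟨ sum-cong-≗ pointwise ⟩
    sum (λ x → 𝟙[ ¬? (isCycleLeast? u x) ] + 𝟙[ x ≟ mb ])
      ≡⟨ ∑-distrib-+ (λ x → 𝟙[ ¬? (isCycleLeast? u x) ]) (λ x → 𝟙[ x ≟ mb ]) ⟩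
    ℓ u + sum (λ x → 𝟙[ x ≟ mb ])
      ≡⟨ cong (ℓ u +_) (sum-𝟙-≟ mb) ⟩
    ℓ u + 1 ∎
    where
    open ≡-Reasoning
    leastᵘ⇒leastᵛ : ∀ {x} → x ≢ mb → IsCycleLeast u x → IsCycleLeast v x
    leastᵘ⇒leastᵛ x≢mb x-least y x~y with to-joined x~y
    ... | inj₁ x~ᵘy = x-least y x~ᵘy
    ... | inj₂ (inj₁ (x~a , y~b)) rewrite cycleLeast-unique u (sameCycle-trans u x~a a~ma) x-least ma-least =
      ℕ.≤-trans (ℕ.<⇒≤ ma<mb) (mb-least y (sameCycle-trans u (sameCycle-sym u b~mb) (sameCycle-sym u y~b) ))
    ... | inj₂ (inj₂ (x~b , _)) = ⊥-elim (x≢mb (cycleLeast-unique u (sameCycle-trans u x~b b~mb) x-least mb-least))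

    pointwise : ∀ x → 𝟙[ ¬? (isCycleLeast? v x) ] ≡ 𝟙[ ¬? (isCycleLeast? u x) ] + 𝟙[ x ≟ mb ]
    pointwise x with x ≟ mb
    ... | yes refl = trans
      (𝟙-yes (¬? (isCycleLeast? v mb)) (λ mb-leastᵛ → ℕ.<⇒≱ ma<mb (mb-leastᵛ ma (from-joined
        (inj₂ (inj₂ (sameCycle-sym u b~mb , sameCycle-sym u a~ma)))))))
      (cong (_+ 1) (sym (𝟙-no (¬? (isCycleLeast? u mb)) (λ ¬least → ¬least mb-least))))
    ... | no x≢mb = trans
      (𝟙-cong (¬? (isCycleLeast? v x)) (¬? (isCycleLeast? u x))
        (λ ¬leastᵛ leastᵘ → ¬leastᵛ (leastᵘ⇒leastᵛ x≢mb leastᵘ))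
        (λ ¬leastᵘ leastᵛ → ¬leastᵘ (λ y x~y → leastᵛ y (from-joined (inj₁ x~y)))))
      (sym (ℕ.+-identityʳ _))

ℓ-join : {u v : Perm n} {a b : Fin n} → ¬ SameCycle u a b →
  (∀ {x y} → SameCycle v x y → Joined u a b x y) → (∀ {x y} → Joined u a b x y → SameCycle v x y) →
  ℓ v ≡ ℓ u + 1
ℓ-join {u = u} {a = a} {b} a≁b to-joined from-joined with cycleLeast u a | cycleLeast u b
... | ma , a~ma , ma-least | mb , b~mb , mb-least with ℕ.<-cmp (toℕ ma) (toℕ mb)
... | tri< ma<mb _ _ = ℓ-join-ordered to-joined from-joined a~ma ma-least b~mb mb-least ma<mb
... | tri> _ _ mb<ma = ℓ-join-ordered (λ x~y → joined-swap (to-joined x~y)) (λ j → from-joined (joined-swap j))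
                          b~mb mb-least a~ma ma-least mb<ma
... | tri≈ _ ma≡mb _ = ⊥-elim (a≁b (sameCycle-trans u a~ma
                          (subst (λ m → SameCycle u m b) (toℕ-injective (sym ma≡mb)) (sameCycle-sym u b~mb))))

ℓ-sameCycle-cong : {u v : Perm n} → (∀ {x y} → SameCycle u x y → SameCycle v x y) →
  (∀ {x y} → SameCycle v x y → SameCycle u x y) → ℓ u ≡ ℓ v
ℓ-sameCycle-cong {u = u} {v} u⊆v v⊆u = sum-cong-≗ λ x →
  𝟙-cong (¬? (isCycleLeast? u x)) (¬? (isCycleLeast? v x))
    (λ ¬leastᵘ leastᵛ → ¬leastᵘ (λ y x~y → leastᵛ y (u⊆v x~y)))
    (λ ¬leastᵛ leastᵘ → ¬leastᵛ (λ y x~y → leastᵘ y (v⊆u x~y)))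

ℓ-cong : {u v : Perm n} → u ≈ v → ℓ u ≡ ℓ v
ℓ-cong u≈v = ℓ-sameCycle-cong (sameCycle-cong u≈v) (sameCycle-cong (λ x → sym (u≈v x)))

ℓ-inverse : (u : Perm n) → ℓ (u ⁻¹) ≡ ℓ u
ℓ-inverse u = ℓ-sameCycle-cong
  (λ x~y → sameCycle-sym u (sameCycle-inverse (u ⁻¹) x~y))
  (λ x~y → sameCycle-inverse u (sameCycle-sym u x~y))

ℓ-id : ℓ (e {n}) ≡ 0
ℓ-id {n} = trans
  (sum-cong-≗ λ x → 𝟙-no (¬? (isCycleLeast? (e {n}) x)) λ ¬least →
     ¬least λ y x~y → ℕ.≤-reflexive (cong toℕ (sym (sameCycle-fixed e refl x~y))))
  (sum-replicate-zero n)

ℓ-transpose-merge : {u v : Perm n} {a b : Fin n} → a ≢ b → transpose a b · u ≈ v →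
  ¬ SameCycle u a b → ℓ v ≡ ℓ u + 1
ℓ-transpose-merge {u = u} {v} a≢b uv a≁b =
  ℓ-join a≁b (sameCycle⇒joined {u = u} {v} a≢b uv a≁b) (joined⇒sameCycle {u = u} {v} a≢b uv a≁b)

ℓ-transpose-split : {u v : Perm n} {a b : Fin n} → a ≢ b → transpose a b · u ≈ v →
  SameCycle u a b → ℓ u ≡ ℓ v + 1
ℓ-transpose-split {u = u} {v} {a} {b} a≢b uv a~b =
  ℓ-transpose-merge a≢b (transpose-flip a b {u} {v} uv) (sameCycle-split {u = u} {v} a≢b uv a~b)

ℓ-transpose-≤ : (u : Perm n) {a b : Fin n} → a ≢ b → ℓ (transpose a b · u) ≤ ℓ u + 1
ℓ-transpose-≤ u {a} {b} a≢b with sameCycle? u a b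
... | yes a~b = ℕ.≤-trans (ℕ.m≤m+n _ 1)
                  (ℕ.≤-trans (ℕ.≤-reflexive (sym (ℓ-transpose-split a≢b (λ _ → refl) a~b))) (ℕ.m≤m+n _ 1))
... | no a≁b  = ℕ.≤-reflexive (ℓ-transpose-merge a≢b (λ _ → refl) a≁b)

ℓ-decrease⇒sameCycle : {u v : Perm n} {a b : Fin n} → a ≢ b → transpose a b · u ≈ v →
  ℓ u ≡ ℓ v + 1 → SameCycle u a b
ℓ-decrease⇒sameCycle {u = u} {v} {a} {b} a≢b uv ℓu≡ℓv+1 with sameCycle? u a b
... | yes a~b = a~b
... | no a≁b  = ⊥-elim (ℕ.m≢1+m+n (ℓ u) (begin
  ℓ u             ≡⟨ ℓu≡ℓv+1 ⟩
  ℓ v + 1         ≡⟨ cong (_+ 1) (ℓ-transpose-merge a≢b uv a≁b) ⟩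
  ℓ u + 1 + 1     ≡⟨ ℕ.+-comm (ℓ u + 1) 1 ⟩
  suc (ℓ u + 1)   ∎))
  where open ≡-Reasoning

ℓ-transpose : {a b : Fin n} → a ≢ b → ℓ (transpose a b) ≡ 1
ℓ-transpose {n} a≢b = trans (ℓ-transpose-merge a≢b (λ _ → refl) (λ a~b → a≢b (sym (sameCycle-fixed e refl a~b))))
                            (cong (_+ 1) (ℓ-id {n}))

-- Factorisations into transpositions

prodT-++ : (ts ts′ : List (Fin n × Fin n)) → prodT (ts ++ ts′) ≈ prodT ts · prodT ts′
prodT-++ []              ts′ x = refl
prodT-++ ((i , j) ∷ ts) ts′ x = cong (transpose i j ⟨$⟩ʳ_) (prodT-++ ts ts′ x)

ℓ-prodT≤length : (ts : List (Fin n × Fin n)) → All (λ { (i , j) → i ≢ j }) ts → ℓ (prodT ts) ≤ length ts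
ℓ-prodT≤length {n} []              []         = ℕ.≤-reflexive (ℓ-id {n})
ℓ-prodT≤length ((i , j) ∷ ts) (i≢j ∷ ts≢) = ℕ.≤-trans (ℓ-transpose-≤ (prodT ts) i≢j)
  (ℕ.≤-trans (ℕ.+-monoˡ-≤ 1 (ℓ-prodT≤length ts ts≢)) (ℕ.≤-reflexive (ℕ.+-comm (length ts) 1)))

ℓ-minimal : {k : ℕ} {w : Perm n} → IsProdOfT k w → ℓ w ≤ k
ℓ-minimal (ts , refl , ts≢ , ts≈w) =
  ℕ.≤-trans (ℕ.≤-reflexive (ℓ-cong (λ x → sym (ts≈w x)))) (ℓ-prodT≤length ts ts≢)

moved-or-id : (u : Perm n) → (∃ λ x → x ≢ u ⟨$⟩ʳ x) ⊎ e ≈ u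
moved-or-id u with any? (λ x → ¬? (x ≟ u ⟨$⟩ʳ x))
... | yes moved = inj₁ moved
... | no none = inj₂ id≈u
  where
  id≈u : e ≈ u
  id≈u x with x ≟ u ⟨$⟩ʳ x
  ... | yes x≡ux = x≡ux
  ... | no x≢ux  = ⊥-elim (none (x , x≢ux))

ℓ-peel : (u : Perm n) {x : Fin n} → x ≢ u ⟨$⟩ʳ x → ℓ u ≡ suc (ℓ (transpose x (u ⟨$⟩ʳ x) · u))
ℓ-peel u {x} x≢ux = trans (ℓ-transpose-split x≢ux (λ _ → refl) (sameCycle-step u x)) (ℕ.+-comm _ 1)

factorise : (k : ℕ) (u : Perm n) → ℓ u ≡ k → IsProdOfT k u
factorise k u ℓu≡k with moved-or-id u
factorise {n} k u ℓu≡k | inj₂ id≈u =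
  subst (λ k → IsProdOfT k u) (trans (sym (ℓ-id {n})) (trans (ℓ-cong id≈u) ℓu≡k)) ([] , refl , [] , id≈u)
factorise zero u ℓu≡0 | inj₁ (x , x≢ux) = ⊥-elim (ℕ.1+n≢0 (trans (sym (ℓ-peel u x≢ux)) ℓu≡0))
factorise (suc k) u ℓu≡1+k | inj₁ (x , x≢ux)
  with factorise k (transpose x (u ⟨$⟩ʳ x) · u) (ℕ.suc-injective (trans (sym (ℓ-peel u x≢ux)) ℓu≡1+k))
... | ts , len , ts≢ , ts≈ = (x , u ⟨$⟩ʳ x) ∷ ts , cong suc len , x≢ux ∷ ts≢ ,
  λ y → trans (cong (transpose x (u ⟨$⟩ʳ x) ⟨$⟩ʳ_) (ts≈ y)) (transpose-involutive x (u ⟨$⟩ʳ x) (u ⟨$⟩ʳ y))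

hasLengthT-ℓ : (u : Perm n) → HasLengthT u (ℓ u)
hasLengthT-ℓ u = factorise (ℓ u) u refl , λ _ → ℓ-minimal

hasLengthT⇒≡ℓ : {u : Perm n} {k : ℕ} → HasLengthT u k → k ≡ ℓ u
hasLengthT⇒≡ℓ {u = u} (k-fact , k-min) = ℕ.≤-antisym (k-min (ℓ u) (factorise (ℓ u) u refl)) (ℓ-minimal k-fact)

ℓ-·-≤ : (u v : Perm n) → ℓ (u · v) ≤ ℓ u + ℓ v
ℓ-·-≤ u v with factorise (ℓ u) u refl | factorise (ℓ v) v refl
... | ts , ts-len , ts≢ , ts≈u | ts′ , ts′-len , ts′≢ , ts′≈v = ℓ-minimal
  (ts ++ ts′ , trans (length-++ ts) (cong₂ _+_ ts-len ts′-len) , ++⁺ ts≢ ts′≢ ,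
   λ x → trans (prodT-++ ts ts′ x) (trans (cong (prodT ts ⟨$⟩ʳ_) (ts′≈v x)) (ts≈u _)))

-- Absolute order

≤T⇒ℓ : {v w : Perm n} → v ≤T w → ℓ (w · v ⁻¹) + ℓ v ≡ ℓ w
≤T⇒ℓ (_ , _ , _ , ℓ₁ , ℓ₂ , ℓ₃ , eq) =
  trans (cong₂ _+_ (sym (hasLengthT⇒≡ℓ ℓ₁)) (sym (hasLengthT⇒≡ℓ ℓ₃))) (trans eq (hasLengthT⇒≡ℓ ℓ₂))

ℓ⇒≤T : {v w : Perm n} → ℓ (w · v ⁻¹) + ℓ v ≡ ℓ w → v ≤T w
ℓ⇒≤T {v = v} {w} eq = _ , _ , _ , hasLengthT-ℓ (w · v ⁻¹) , hasLengthT-ℓ w , hasLengthT-ℓ v , eq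

⁻¹-cong : {u v : Perm n} → u ≈ v → u ⁻¹ ≈ v ⁻¹
⁻¹-cong {u = u} {v} u≈v x = ⟨$⟩ʳ-injective v (trans (sym (u≈v _)) (trans (inverseʳ u) (sym (inverseʳ v))))

≤T-congˡ : {v v′ w : Perm n} → v ≈ v′ → v ≤T w → v′ ≤T w
≤T-congˡ {v = v} {v′} {w} v≈v′ v≤w = ℓ⇒≤T {v = v′} {w} (trans
  (cong₂ _+_ (ℓ-cong {u = w · v′ ⁻¹} {w · v ⁻¹} λ x → cong (w ⟨$⟩ʳ_) (⁻¹-cong {u = v′} {v} v′≈v x))
             (ℓ-cong {u = v′} {v} v′≈v))
  (≤T⇒ℓ v≤w))
  where
  v′≈v : v′ ≈ v
  v′≈v x = sym (v≈v′ x)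

e≤T : (u : Perm n) → e ≤T u
e≤T {n} u = ℓ⇒≤T (trans (cong (ℓ u +_) (ℓ-id {n})) (ℕ.+-identityʳ (ℓ u)))

≤T-trans : {u v w : Perm n} → u ≤T v → v ≤T w → u ≤T w
≤T-trans {u = u} {v} {w} u≤v v≤w = ℓ⇒≤T (ℕ.≤-antisym ≤ℓw ℓw≤)
  where
  ≤ℓw : ℓ (w · u ⁻¹) + ℓ u ≤ ℓ w
  ≤ℓw = begin
    ℓ (w · u ⁻¹) + ℓ u
      ≡⟨ cong (_+ ℓ u) (ℓ-cong λ x → cong (w ⟨$⟩ʳ_) (sym (inverseˡ v))) ⟩
    ℓ ((w · v ⁻¹) · (v · u ⁻¹)) + ℓ u
      ≤⟨ ℕ.+-monoˡ-≤ (ℓ u) (ℓ-·-≤ (w · v ⁻¹) (v · u ⁻¹)) ⟩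
    ℓ (w · v ⁻¹) + ℓ (v · u ⁻¹) + ℓ u
      ≡⟨ ℕ.+-assoc (ℓ (w · v ⁻¹)) _ _ ⟩
    ℓ (w · v ⁻¹) + (ℓ (v · u ⁻¹) + ℓ u)
      ≡⟨ cong (ℓ (w · v ⁻¹) +_) (≤T⇒ℓ u≤v) ⟩
    ℓ (w · v ⁻¹) + ℓ v
      ≡⟨ ≤T⇒ℓ v≤w ⟩
    ℓ w ∎
    where open ℕ.≤-Reasoning
  ℓw≤ : ℓ w ≤ ℓ (w · u ⁻¹) + ℓ u
  ℓw≤ = ℕ.≤-trans (ℕ.≤-reflexive (ℓ-cong λ x → cong (w ⟨$⟩ʳ_) (sym (inverseˡ u)))) (ℓ-·-≤ (w · u ⁻¹) u)

ℓ-·transpose⁻¹ : (w : Perm n) (a b : Fin n) → ℓ (w · transpose a b ⁻¹) ≡ ℓ (transpose a b · w ⁻¹)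
ℓ-·transpose⁻¹ w a b =
  trans (sym (ℓ-inverse (w · transpose a b ⁻¹))) (ℓ-cong {v = transpose a b · w ⁻¹} λ _ → refl)

≤T⇒ℓ≤ : {v w : Perm n} → v ≤T w → ℓ v ≤ ℓ w
≤T⇒ℓ≤ {v = v} {w} v≤w = subst (ℓ v ≤_) (≤T⇒ℓ v≤w) (ℕ.m≤n+m (ℓ v) _)

split≤T : {p : Perm n} {a b : Fin n} → a ≢ b → SameCycle p a b → (transpose a b · p) ≤T p
split≤T {p = p} {a} {b} a≢b a~b = ℓ⇒≤T {v = transpose a b · p} {p} (begin
  ℓ (p · (transpose a b · p) ⁻¹) + ℓ (transpose a b · p) ≡⟨ cong (_+ ℓ (transpose a b · p)) ℓ[p·u⁻¹]≡1 ⟩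
  1 + ℓ (transpose a b · p)                             ≡⟨ ℕ.+-comm 1 _ ⟩
  ℓ (transpose a b · p) + 1                             ≡⟨ sym (ℓ-transpose-split a≢b (λ _ → refl) a~b) ⟩
  ℓ p                                                   ∎)
  where
  open ≡-Reasoning
  ℓ[p·u⁻¹]≡1 : ℓ (p · (transpose a b · p) ⁻¹) ≡ 1
  ℓ[p·u⁻¹]≡1 = trans (ℓ-cong {v = transpose b a} λ _ → inverseʳ p) (ℓ-transpose (λ b≡a → a≢b (sym b≡a)))

sameCycle⇒transpose≤T : {w : Perm n} {a b : Fin n} → a ≢ b → SameCycle w a b → transpose a b ≤T w
sameCycle⇒transpose≤T {w = w} {a} {b} a≢b a~b = ℓ⇒≤T (begin
  ℓ (w · transpose a b ⁻¹) + ℓ (transpose a b)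
    ≡⟨ cong₂ _+_ (ℓ-·transpose⁻¹ w a b) (ℓ-transpose a≢b) ⟩
  ℓ (transpose a b · w ⁻¹) + 1
    ≡⟨ sym (ℓ-transpose-split a≢b (λ _ → refl) (sameCycle-inverse w (sameCycle-sym w a~b))) ⟩
  ℓ (w ⁻¹)
    ≡⟨ ℓ-inverse w ⟩
  ℓ w ∎)
  where open ≡-Reasoning

transpose≤T⇒sameCycle : {w : Perm n} {a b : Fin n} → a ≢ b → transpose a b ≤T w → SameCycle w a b
transpose≤T⇒sameCycle {w = w} {a} {b} a≢b t≤w =
  sameCycle-sym w (sameCycle-inverse (w ⁻¹) (ℓ-decrease⇒sameCycle a≢b (λ _ → refl) (begin
    ℓ (w ⁻¹)                                     ≡⟨ ℓ-inverse w ⟩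
    ℓ w                                          ≡⟨ sym (≤T⇒ℓ t≤w) ⟩
    ℓ (w · transpose a b ⁻¹) + ℓ (transpose a b) ≡⟨ cong₂ _+_ (ℓ-·transpose⁻¹ w a b) (ℓ-transpose a≢b) ⟩
    ℓ (transpose a b · w ⁻¹) + 1                 ∎)))
  where open ≡-Reasoning

-- The join π_T(w, c)

module _ {c w p : Perm n} (p-is-π : IsPiT c w p) where

  private
    p≤c : p ≤T c
    p≤c = proj₂ (proj₁ p-is-π)

    p-upper : ∀ s → IsTransposition s × s ≤T w → s ≤T p
    p-upper = proj₁ (proj₂ p-is-π)

    p-least : ∀ u → InNC c u → (∀ s → IsTransposition s × s ≤T w → s ≤T u) → p ≤T u
    p-least = proj₂ (proj₂ p-is-π)

  π-sameCycle : ∀ j → SameCycle p j (w ⟨$⟩ʳ j)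
  π-sameCycle j with j ≟ w ⟨$⟩ʳ j
  ... | yes j≡wj = subst (SameCycle p j) j≡wj (sameCycle-refl p j)
  ... | no j≢wj  = transpose≤T⇒sameCycle j≢wj (p-upper (transpose j (w ⟨$⟩ʳ j))
                     ((j , w ⟨$⟩ʳ j , j≢wj , λ _ → refl) , sameCycle⇒transpose≤T j≢wj (sameCycle-step w j)))

  -- Otherwise splitting j off its p-cycle gives a smaller element of NC(c) that is still an upper bound.
  π-fixes : ∀ j → w ⟨$⟩ʳ j ≡ j → p ⟨$⟩ʳ j ≡ j
  π-fixes j wj≡j with j ≟ p ⟨$⟩ʳ j
  ... | yes j≡pj = sym j≡pj
  ... | no j≢pj = ⊥-elim (ℕ.m+1+n≰m (ℓ u) (subst (_≤ ℓ u) ℓp≡ℓu+1 (≤T⇒ℓ≤ {v = p} {u} p≤u)))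
    where
    u : Perm n
    u = transpose j (p ⟨$⟩ʳ j) · p

    ℓp≡ℓu+1 : ℓ p ≡ ℓ u + 1
    ℓp≡ℓu+1 = ℓ-transpose-split j≢pj (λ _ → refl) (sameCycle-step p j)

    u-upper : ∀ s → IsTransposition s × s ≤T w → s ≤T u
    u-upper s s-below@((a , b , a≢b , s≈t) , s≤w) = ≤T-congˡ {v = transpose a b} {s} {u} (λ x → sym (s≈t x))
      (sameCycle⇒transpose≤T a≢b
        (sameCycle-splitOff {w = w} {p} j≢pj a≢b wj≡j (below s≤w) (below (p-upper s s-below))))
      where
      below : ∀ {q} → s ≤T q → SameCycle q a b
      below {q} s≤q = transpose≤T⇒sameCycle a≢b (≤T-congˡ {v = s} {transpose a b} {q} s≈t s≤q)

    p≤u : p ≤T u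
    p≤u = p-least u (e≤T u , ≤T-trans {u = u} {p} {c} (split≤T j≢pj (sameCycle-step p j)) p≤c) u-upper

-- Cyclic distance

dist : Fin n → Fin n → ℕ
dist {n} x y with toℕ x ℕ.≤? toℕ y
... | yes _ = toℕ y ∸ toℕ x
... | no _  = n ∸ toℕ x + toℕ y

dist-view : (x y : Fin n) →
  (toℕ x ≤ toℕ y × dist x y + toℕ x ≡ toℕ y) ⊎ (toℕ y < toℕ x × dist x y + toℕ x ≡ n + toℕ y)
dist-view {n} x y with toℕ x ℕ.≤? toℕ y
... | yes x≤y = inj₁ (x≤y , ℕ.m∸n+n≡m x≤y)
... | no x≰y  = inj₂ (ℕ.≰⇒> x≰y , trans (xy∙z≈xz∙y (n ∸ toℕ x) (toℕ y) (toℕ x))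
                                        (cong (_+ toℕ y) (ℕ.m∸n+n≡m (ℕ.<⇒≤ (toℕ<n x)))))

dist-pos : {x y : Fin n} → y ≢ x → 0 < dist x y
dist-pos {n} {x} {y} y≢x with dist-view x y
... | inj₁ (_ , eq) = ℕ.n≢0⇒n>0 λ d≡0 → y≢x (toℕ-injective (trans (sym eq) (cong (_+ toℕ x) d≡0)))
... | inj₂ (_ , eq) = ℕ.n≢0⇒n>0 λ d≡0 → ℕ.<⇒≱ (toℕ<n x)
                        (ℕ.≤-trans (ℕ.m≤m+n n (toℕ y)) (ℕ.≤-reflexive (trans (sym eq) (cong (_+ toℕ x) d≡0))))

dist-additive : (x a y : Fin n) → dist x a ≤ dist x y → dist x y ≡ dist x a + dist a y
dist-additive {n} x a y le with dist-view x a | dist-view x y | dist-view a y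
... | inj₁ (_ , xa) | inj₁ (_ , xy) | inj₁ (_ , ay) = ℕ.+-cancelʳ-≡ (toℕ x) _ _
  (trans xy (trans (sym ay) (trans (cong (dist a y +_) (sym xa)) (x∙yz≈yx∙z (dist a y) (dist x a) (toℕ x)))))
... | inj₁ (_ , xa) | inj₁ (_ , xy) | inj₂ (y<a , _) = ⊥-elim (ℕ.<⇒≱ y<a
  (subst₂ _≤_ xa xy (ℕ.+-monoˡ-≤ (toℕ x) le)))
... | inj₁ (x≤a , _) | inj₂ (y<x , _) | inj₁ (a≤y , _) = ⊥-elim (ℕ.<⇒≱ y<x (ℕ.≤-trans x≤a a≤y))
... | inj₁ (_ , xa) | inj₂ (_ , xy) | inj₂ (_ , ay) = ℕ.+-cancelʳ-≡ (toℕ x) _ _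
  (trans xy (trans (sym ay) (trans (cong (dist a y +_) (sym xa)) (x∙yz≈yx∙z (dist a y) (dist x a) (toℕ x)))))
... | inj₂ (_ , xa) | inj₁ (_ , xy) | _ = ⊥-elim (ℕ.<⇒≱ (toℕ<n y)
  (ℕ.≤-trans (ℕ.m≤m+n n (toℕ a)) (subst₂ _≤_ xa xy (ℕ.+-monoˡ-≤ (toℕ x) le))))
... | inj₂ (_ , xa) | inj₂ (_ , xy) | inj₂ (y<a , _) = ⊥-elim (ℕ.<⇒≱ y<a
  (ℕ.+-cancelˡ-≤ n _ _ (subst₂ _≤_ xa xy (ℕ.+-monoˡ-≤ (toℕ x) le))))
... | inj₂ (_ , xa) | inj₂ (_ , xy) | inj₁ (_ , ay) = ℕ.+-cancelʳ-≡ (toℕ x) _ _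
  (trans xy (trans (cong (n +_) (sym ay)) (trans (x∙yz≈y∙xz n (dist a y) (toℕ a))
    (trans (cong (dist a y +_) (sym xa)) (x∙yz≈yx∙z (dist a y) (dist x a) (toℕ x))))))

dist-complement : {x y : Fin n} → y ≢ x → dist x y + dist y x ≡ n
dist-complement {n} {x} {y} y≢x with dist-view x y | dist-view y x
... | inj₁ (x≤y , _) | inj₁ (y≤x , _) = ⊥-elim (y≢x (toℕ-injective (ℕ.≤-antisym y≤x x≤y)))
... | inj₂ (y<x , _) | inj₂ (x<y , _) = ⊥-elim (ℕ.<-asym y<x x<y)
... | inj₁ (_ , xy) | inj₂ (_ , yx) = ℕ.+-cancelʳ-≡ (toℕ x) _ _
  (trans (xy∙z≈y∙xz (dist x y) (dist y x) (toℕ x)) (trans (cong (dist y x +_) xy) yx))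
... | inj₂ (_ , xy) | inj₁ (_ , yx) = ℕ.+-cancelʳ-≡ (toℕ y) _ _
  (trans (ℕ.+-assoc (dist x y) (dist y x) (toℕ y)) (trans (cong (dist x y +_) yx) xy))

dist-reverse : {a w z : Fin n} → w ≢ a → z ≢ a → z ≢ w → dist w z ≤ dist w a → dist a w < dist a z
dist-reverse {n} {a} {w} {z} w≢a z≢a z≢w le = ℕ.+-cancelʳ-< (dist z a) _ _ (begin-strict
  dist a w + dist z a                ≡⟨ ℕ.+-comm (dist a w) _ ⟩
  dist z a + dist a w                <⟨ ℕ.m<n+m _ (dist-pos z≢w) ⟩
  dist w z + (dist z a + dist a w)   ≡⟨ sym (ℕ.+-assoc (dist w z) _ _) ⟩
  dist w z + dist z a + dist a w     ≡⟨ cong (_+ dist a w) (sym (dist-additive w z a le)) ⟩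
  dist w a + dist a w                ≡⟨ ℕ.+-comm (dist w a) _ ⟩
  dist a w + dist w a                ≡⟨ dist-complement w≢a ⟩
  n                                  ≡⟨ sym (dist-complement z≢a) ⟩
  dist a z + dist z a                ∎)
  where open ℕ.≤-Reasoning

dist-shift : (x a y b : Fin n) → dist x a ≤ dist x y → dist x y < dist x b → dist a y < dist a b
dist-shift x a y b le lt = ℕ.+-cancelˡ-< (dist x a) _ _ (begin-strict
  dist x a + dist a y  ≡⟨ sym (dist-additive x a y le) ⟩
  dist x y             <⟨ lt ⟩
  dist x b             ≡⟨ dist-additive x a b (ℕ.≤-trans le (ℕ.<⇒≤ lt)) ⟩
  dist x a + dist a b  ∎)
  where open ℕ.≤-Reasoning

-- Cyclically increasing permutations

-- q x is the first point of the q-cycle of x met when walking x, x + 1, … around ℤ/n.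
CyclicallyIncreasing : Perm n → Set
CyclicallyIncreasing q = ∀ x y → SameCycle q x y → y ≢ x → dist x (q ⟨$⟩ʳ x) ≤ dist x y

cyclicallyIncreasing-cong : {q q′ : Perm n} → q ≈ q′ → CyclicallyIncreasing q → CyclicallyIncreasing q′
cyclicallyIncreasing-cong {q = q} {q′} q≈q′ q-inc x y x~y y≢x =
  subst (λ z → dist x z ≤ dist x y) (q≈q′ x) (q-inc x y (sameCycle-cong (λ z → sym (q≈q′ z)) x~y) y≢x)

module _ {q : Perm n} {a b : Fin n} (a≢b : a ≢ b) (a~b : SameCycle q a b) (q-inc : CyclicallyIncreasing q) where

  private
    v : Perm n
    v = transpose a b · q

    a≁ᵛb : ¬ SameCycle v a b
    a≁ᵛb = sameCycle-split {u = q} {v} a≢b (λ _ → refl) a~b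

    v⊆q : ∀ {x y} → SameCycle v x y → SameCycle q x y
    v⊆q = sameCycle-merge⁺ {u = v} {q} a≢b (transpose-flip a b {q} {v} (λ _ → refl)) a≁ᵛb

    dist<⇒≢ : {c z c̄ : Fin n} → dist c z < dist c c̄ → z ≢ c̄
    dist<⇒≢ z<c̄ refl = ℕ.<-irrefl refl z<c̄

    before-partner : (c c̄ : Fin n) → (∀ {z} → z ≢ c → z ≢ c̄ → transpose a b ⟨$⟩ʳ z ≡ z) →
      ∀ k z → dist c z < k → SameCycle q c z → dist c z < dist c c̄ → SameCycle v c z
    before-partner c c̄ τz (suc k) z z<k c~z z<c̄ with z ≟ c | q ⟨$⟩ˡ z ≟ c
    ... | yes refl | _ = sameCycle-refl v z
    ... | no z≢c | yes z′≡c = 1 , trans (cong (transpose a b ⟨$⟩ʳ_) (trans (cong (q ⟨$⟩ʳ_) (sym z′≡c)) (inverseʳ q)))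
                                        (τz z≢c (dist<⇒≢ {c = c} z<c̄))
    ... | no z≢c | no z′≢c = sameCycle-trans v c~z′
                               (1 , trans (cong (transpose a b ⟨$⟩ʳ_) (inverseʳ q)) (τz z≢c (dist<⇒≢ {c = c} z<c̄)))
      where
      z′ : Fin n
      z′ = q ⟨$⟩ˡ z
      c~ᵠz′ : SameCycle q c z′
      c~ᵠz′ = sameCycle-trans q c~z (sameCycle-sym q (1 , inverseʳ q))
      z≢z′ : z ≢ z′
      z≢z′ z≡z′ = z′≢c (sym (sameCycle-fixed q {z′} (trans (inverseʳ q) z≡z′) (sameCycle-sym q c~ᵠz′)))
      z′<z : dist c z′ < dist c z
      z′<z = dist-reverse (λ z′≡c → z′≢c z′≡c) z≢c z≢z′
               (subst (λ t → dist z′ t ≤ dist z′ c) (inverseʳ q) (q-inc z′ c (sameCycle-sym q c~ᵠz′) (λ c≡z′ → z′≢c (sym c≡z′))))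
      c~z′ : SameCycle v c z′
      c~z′ = before-partner c c̄ τz k z′ (ℕ.<-≤-trans z′<z (ℕ.≤-pred z<k)) c~ᵠz′ (ℕ.<-trans z′<z z<c̄)

    -- If q x = c then v x = c̄; any point of the v-cycle of x before c̄ would put c and c̄ on one v-cycle.
    jump-increasing : (c c̄ : Fin n) → (∀ {z} → z ≢ c → z ≢ c̄ → transpose a b ⟨$⟩ʳ z ≡ z) →
      transpose a b ⟨$⟩ʳ c ≡ c̄ → ¬ SameCycle v c c̄ →
      ∀ x y → q ⟨$⟩ʳ x ≡ c → SameCycle v x y → y ≢ x → dist x c̄ ≤ dist x y
    jump-increasing c c̄ τz τc c≁c̄ x y qx≡c x~y y≢x with dist x c̄ ℕ.≤? dist x y
    ... | yes c̄≤y = c̄≤y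
    ... | no c̄≰y = ⊥-elim (c≁c̄ (sameCycle-trans v c~y (sameCycle-trans v (sameCycle-sym v x~y)
                      (1 , trans (cong (transpose a b ⟨$⟩ʳ_) qx≡c) τc))))
      where
      c≤y : dist x c ≤ dist x y
      c≤y = subst (λ t → dist x t ≤ dist x y) qx≡c (q-inc x y (v⊆q x~y) y≢x)
      c~y : SameCycle v c y
      c~y = before-partner c c̄ τz (suc (dist c y)) y (ℕ.n<1+n _)
              (sameCycle-trans q (sameCycle-sym q (1 , qx≡c)) (v⊆q x~y))
              (dist-shift x c y c̄ c≤y (ℕ.≰⇒> c̄≰y))

  cyclicallyIncreasing-split : CyclicallyIncreasing (transpose a b · q)
  cyclicallyIncreasing-split x y x~y y≢x with ≡-either (q ⟨$⟩ʳ x) a b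
  ... | inj₁ qx≡a = subst (λ t → dist x t ≤ dist x y)
                         (sym (trans (cong (transpose a b ⟨$⟩ʳ_) qx≡a) (transpose-matchˡ a b)))
                         (jump-increasing a b (transpose-other a b) (transpose-matchˡ a b) a≁ᵛb x y qx≡a x~y y≢x)
  ... | inj₂ (inj₁ qx≡b) = subst (λ t → dist x t ≤ dist x y)
                         (sym (trans (cong (transpose a b ⟨$⟩ʳ_) qx≡b) (transpose-matchʳ a b)))
                         (jump-increasing b a (λ z≢b z≢a → transpose-other a b z≢a z≢b) (transpose-matchʳ a b)
                           (λ b~a → a≁ᵛb (sameCycle-sym v b~a)) x y qx≡b x~y y≢x)
  ... | inj₂ (inj₂ (qx≢a , qx≢b)) = subst (λ t → dist x t ≤ dist x y) (sym (transpose-other a b qx≢a qx≢b))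
                              (q-inc x y (v⊆q x~y) y≢x)

cyclicallyIncreasing-prodT : (ts : List (Fin n × Fin n)) → All (λ { (i , j) → i ≢ j }) ts →
  {p q : Perm n} → CyclicallyIncreasing q → prodT ts · p ≈ q → ℓ q ≡ length ts + ℓ p → CyclicallyIncreasing p
cyclicallyIncreasing-prodT [] [] {p} {q} q-inc p≈q _ = cyclicallyIncreasing-cong {q = q} {p} (λ x → sym (p≈q x)) q-inc
cyclicallyIncreasing-prodT {n} ((i , j) ∷ ts) (i≢j ∷ ts≢) {p} {q} q-inc tq′≈q ℓq≡ =
  cyclicallyIncreasing-prodT ts ts≢
    (cyclicallyIncreasing-cong {q = transpose i j · q} {q′} tq≈q′ (cyclicallyIncreasing-split i≢j i~j q-inc))
    (λ _ → refl) ℓq′≡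
  where
  q′ : Perm n
  q′ = prodT ts · p

  tq≈q′ : transpose i j · q ≈ q′
  tq≈q′ = transpose-flip i j {q′} {q} tq′≈q

  ℓq≤ℓq′+1 : ℓ q ≤ ℓ q′ + 1
  ℓq≤ℓq′+1 = ℕ.≤-trans (ℕ.≤-reflexive (ℓ-cong {u = q} {transpose i j · q′} (λ x → sym (tq′≈q x))))
                       (ℓ-transpose-≤ q′ i≢j)

  ℓq′≡ : ℓ q′ ≡ length ts + ℓ p
  ℓq′≡ = ℕ.≤-antisym (ℕ.≤-trans (ℓ-·-≤ (prodT ts) p) (ℕ.+-monoˡ-≤ (ℓ p) (ℓ-prodT≤length ts ts≢)))
    (ℕ.+-cancelʳ-≤ 1 _ _ (subst (_≤ ℓ q′ + 1) (trans ℓq≡ (ℕ.+-comm 1 _)) ℓq≤ℓq′+1))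

  i~j : SameCycle q i j
  i~j = ℓ-decrease⇒sameCycle i≢j tq≈q′ (trans ℓq≡ (trans (cong suc (sym ℓq′≡)) (ℕ.+-comm 1 (ℓ q′))))

≤T-cyclicallyIncreasing : {p q : Perm n} → p ≤T q → CyclicallyIncreasing q → CyclicallyIncreasing p
≤T-cyclicallyIncreasing {p = p} {q} p≤q q-inc with factorise (ℓ (q · p ⁻¹)) (q · p ⁻¹) refl
... | ts , ts-len , ts≢ , ts≈ = cyclicallyIncreasing-prodT ts ts≢ q-inc
  (λ x → trans (ts≈ (p ⟨$⟩ʳ x)) (cong (q ⟨$⟩ʳ_) (inverseˡ p)))
  (trans (sym (≤T⇒ℓ p≤q)) (cong (_+ ℓ p) (sym ts-len)))

coxeter-step : .{{_ : NonZero n}} {c : Perm n} → IsCoxeterElement n c → ∀ x → dist x (c ⟨$⟩ʳ x) ≤ 1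
coxeter-step {n} {c} c-cox x with dist-view x (c ⟨$⟩ʳ x) | ℕ.m≤n⇒m<n∨m≡n (toℕ<n x)
... | inj₁ (_ , eq) | _ = ℕ.+-cancelʳ-≤ (toℕ x) _ 1
  (subst (_≤ suc (toℕ x)) (sym eq) (subst (_≤ suc (toℕ x)) (sym (c-cox x)) (m%n≤m (suc (toℕ x)) n)))
... | inj₂ (cx<x , _) | inj₁ 1+x<n = ⊥-elim (ℕ.<-asym cx<x
  (subst (toℕ x <_) (sym (trans (c-cox x) (m<n⇒m%n≡m 1+x<n))) (ℕ.n<1+n (toℕ x))))
... | inj₂ (_ , eq) | inj₂ 1+x≡n = ℕ.≤-reflexive (ℕ.+-cancelʳ-≡ (toℕ x) _ 1 (begin
  dist x (c ⟨$⟩ʳ x) + toℕ x    ≡⟨ eq ⟩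
  n + toℕ (c ⟨$⟩ʳ x)           ≡⟨ cong (n +_) (trans (c-cox x) (trans (cong (_% n) 1+x≡n) (n%n≡0 n))) ⟩
  n + 0                        ≡⟨ trans (ℕ.+-identityʳ n) (sym 1+x≡n) ⟩
  suc (toℕ x)                  ∎))
  where open ≡-Reasoning

coxeter-cyclicallyIncreasing : .{{_ : NonZero n}} {c : Perm n} → IsCoxeterElement n c → CyclicallyIncreasing c
coxeter-cyclicallyIncreasing {c = c} c-cox x y _ y≢x = ℕ.≤-trans (coxeter-step {c = c} c-cox x) (dist-pos y≢x)

module _ {q : Perm n} (q-inc : CyclicallyIncreasing q) where

  ascent-bound : {x y : Fin n} → toℕ x < toℕ (q ⟨$⟩ʳ x) → SameCycle q x y → y ≢ x →
    toℕ y < toℕ (q ⟨$⟩ʳ x) → toℕ y < toℕ x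
  ascent-bound {x} {y} x<qx x~y y≢x y<qx with dist-view x (q ⟨$⟩ʳ x) | dist-view x y
  ... | inj₂ (qx<x , _) | _ = ⊥-elim (ℕ.<-asym qx<x x<qx)
  ... | _ | inj₂ (y<x , _) = y<x
  ... | inj₁ (_ , x→qx) | inj₁ (_ , x→y) = ⊥-elim (ℕ.<⇒≱ y<qx
    (subst₂ _≤_ x→qx x→y (ℕ.+-monoˡ-≤ (toℕ x) (q-inc x y x~y y≢x))))

  descent-bound : {x y : Fin n} → toℕ (q ⟨$⟩ʳ x) < toℕ x → SameCycle q x y →
    toℕ (q ⟨$⟩ʳ x) ≤ toℕ y × toℕ y ≤ toℕ x
  descent-bound {x} {y} qx<x x~y with y ≟ x
  ... | yes refl = ℕ.<⇒≤ qx<x , ℕ.≤-refl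
  ... | no y≢x with dist-view x (q ⟨$⟩ʳ x) | dist-view x y
  ...   | inj₁ (x≤qx , _) | _ = ⊥-elim (ℕ.<⇒≱ qx<x x≤qx)
  ...   | inj₂ (_ , x→qx) | inj₁ (_ , x→y) = ⊥-elim (ℕ.<⇒≱ (toℕ<n y)
    (ℕ.≤-trans (ℕ.m≤m+n n _) (subst₂ _≤_ x→qx x→y (ℕ.+-monoˡ-≤ (toℕ x) (q-inc x y x~y y≢x)))))
  ...   | inj₂ (_ , x→qx) | inj₂ (y<x , x→y) = ℕ.+-cancelˡ-≤ n _ _
    (subst₂ _≤_ x→qx x→y (ℕ.+-monoˡ-≤ (toℕ x) (q-inc x y x~y y≢x))) , ℕ.<⇒≤ y<x

  cycGt1≡aexc : cycGt1 q ≡ aexc q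
  cycGt1≡aexc = begin
    cycGt1 q
      ≡⟨ count≡sum (λ i → IsCycleMin? q i ×-dec ¬? (q ⟨$⟩ʳ i ≟ i)) ⟩
    sum (λ i → 𝟙[ IsCycleMin? q i ×-dec ¬? (q ⟨$⟩ʳ i ≟ i) ])
      ≡⟨ sum-cong-≗ (λ i → 𝟙-cong (IsCycleMin? q i ×-dec ¬? (q ⟨$⟩ʳ i ≟ i)) (i <ᶠ? q ⟨$⟩ˡ i) (least⇒ i) (⇒least i)) ⟩
    sum (λ i → 𝟙[ i <ᶠ? q ⟨$⟩ˡ i ])
      ≡⟨ sym (count≡sum (λ i → i <ᶠ? q ⟨$⟩ˡ i)) ⟩
    aexc q ∎
    where
    open ≡-Reasoning

    q⁻¹i~i : ∀ i → SameCycle q (q ⟨$⟩ˡ i) i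
    q⁻¹i~i i = 1 , inverseʳ q

    least⇒ : ∀ i → PowersAbove q i × q ⟨$⟩ʳ i ≢ i → toℕ i < toℕ (q ⟨$⟩ˡ i)
    least⇒ i (above , qi≢i) = ℕ.≤∧≢⇒< (powersAbove⇒cycleLeast q i above _ (sameCycle-sym q (q⁻¹i~i i)))
      (λ i≡q⁻¹i → qi≢i (trans (cong (q ⟨$⟩ʳ_) (toℕ-injective i≡q⁻¹i)) (inverseʳ q)))

    -- i is q(z) for the descent z = q⁻¹ i, so its whole cycle lies above it.
    ⇒least : ∀ i → toℕ i < toℕ (q ⟨$⟩ˡ i) → PowersAbove q i × q ⟨$⟩ʳ i ≢ i
    ⇒least i i<q⁻¹i = cycleLeast⇒powersAbove q i (λ y i~y → subst (λ z → toℕ z ≤ toℕ y) (inverseʳ q)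
        (proj₁ (descent-bound (subst (λ z → toℕ z < toℕ (q ⟨$⟩ˡ i)) (sym (inverseʳ q)) i<q⁻¹i)
                              (sameCycle-trans q (q⁻¹i~i i) i~y))))
      , λ qi≡i → ℕ.<-irrefl (cong toℕ (trans (sym (inverseˡ q)) (cong (q ⟨$⟩ˡ_) qi≡i))) i<q⁻¹i

-- Counting antiexceedances

aexc≡sum-drops : (u : Perm n) → aexc u ≡ sum (λ j → 𝟙[ u ⟨$⟩ʳ j <ᶠ? j ])
aexc≡sum-drops u = begin
  aexc u
    ≡⟨ count≡sum (λ i → i <ᶠ? u ⟨$⟩ˡ i) ⟩
  sum (λ i → 𝟙[ i <ᶠ? u ⟨$⟩ˡ i ])
    ≡⟨ ∑-permute (λ i → 𝟙[ i <ᶠ? u ⟨$⟩ˡ i ]) u ⟩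
  sum (λ j → 𝟙[ u ⟨$⟩ʳ j <ᶠ? u ⟨$⟩ˡ (u ⟨$⟩ʳ j) ])
    ≡⟨ sum-cong-≗ (λ j → cong (λ t → 𝟙[ u ⟨$⟩ʳ j <ᶠ? t ]) (inverseˡ u)) ⟩
  sum (λ j → 𝟙[ u ⟨$⟩ʳ j <ᶠ? j ]) ∎
  where open ≡-Reasoning

aexc-PopT : (w p : Perm n) → aexc (PopT w p) ≡ sum (λ j → 𝟙[ w ⟨$⟩ʳ j <ᶠ? p ⟨$⟩ʳ j ])
aexc-PopT w p = begin
  aexc (PopT w p)
    ≡⟨ aexc≡sum-drops (PopT w p) ⟩
  sum (λ i → 𝟙[ w ⟨$⟩ʳ (p ⟨$⟩ˡ i) <ᶠ? i ])
    ≡⟨ ∑-permute (λ i → 𝟙[ w ⟨$⟩ʳ (p ⟨$⟩ˡ i) <ᶠ? i ]) p ⟩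
  sum (λ j → 𝟙[ w ⟨$⟩ʳ (p ⟨$⟩ˡ (p ⟨$⟩ʳ j)) <ᶠ? p ⟨$⟩ʳ j ])
    ≡⟨ sum-cong-≗ (λ j → cong (λ t → 𝟙[ w ⟨$⟩ʳ t <ᶠ? p ⟨$⟩ʳ j ]) (inverseˡ p)) ⟩
  sum (λ j → 𝟙[ w ⟨$⟩ʳ j <ᶠ? p ⟨$⟩ʳ j ]) ∎
  where open ≡-Reasoning

drop-split : {w p : Perm n} → CyclicallyIncreasing p → (∀ j → SameCycle p j (w ⟨$⟩ʳ j)) →
  (∀ j → w ⟨$⟩ʳ j ≡ j → p ⟨$⟩ʳ j ≡ j) →
  ∀ j → 𝟙[ w ⟨$⟩ʳ j <ᶠ? p ⟨$⟩ʳ j ] + 𝟙[ p ⟨$⟩ʳ j <ᶠ? j ] ≡ 𝟙[ w ⟨$⟩ʳ j <ᶠ? j ]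
drop-split {w = w} {p} p-inc j~wj p-fixes j with ℕ.<-cmp (toℕ (p ⟨$⟩ʳ j)) (toℕ j)
... | tri< pj<j _ _ = trans
      (cong₂ _+_ (𝟙-no (w ⟨$⟩ʳ j <ᶠ? p ⟨$⟩ʳ j) (ℕ.≤⇒≯ pj≤wj)) (𝟙-yes (p ⟨$⟩ʳ j <ᶠ? j) pj<j))
      (sym (𝟙-yes (w ⟨$⟩ʳ j <ᶠ? j) wj<j))
  where
  pj≤wj : toℕ (p ⟨$⟩ʳ j) ≤ toℕ (w ⟨$⟩ʳ j)
  pj≤wj = proj₁ (descent-bound p-inc pj<j (j~wj j))
  wj<j : toℕ (w ⟨$⟩ʳ j) < toℕ j
  wj<j = ℕ.≤∧≢⇒< (proj₂ (descent-bound p-inc pj<j (j~wj j)))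
           (λ wj≡j → ℕ.<-irrefl (cong toℕ (p-fixes j (toℕ-injective wj≡j))) pj<j)
... | tri> _ _ j<pj = trans (cong₂ _+_
      (𝟙-cong (w ⟨$⟩ʳ j <ᶠ? p ⟨$⟩ʳ j) (w ⟨$⟩ʳ j <ᶠ? j)
        (ascent-bound p-inc j<pj (j~wj j) wj≢j) (λ wj<j → ℕ.<-trans wj<j j<pj))
      (𝟙-no (p ⟨$⟩ʳ j <ᶠ? j) (ℕ.<-asym j<pj)))
    (ℕ.+-identityʳ _)
  where
  wj≢j : w ⟨$⟩ʳ j ≢ j
  wj≢j wj≡j = ℕ.<-irrefl (sym (cong toℕ (p-fixes j wj≡j))) j<pj
... | tri≈ _ pj≡j _ = trans (cong₂ _+_
      (𝟙-no (w ⟨$⟩ʳ j <ᶠ? p ⟨$⟩ʳ j) (ℕ.<-irrefl (trans (cong toℕ wj≡j) (sym pj≡j))))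
      (𝟙-no (p ⟨$⟩ʳ j <ᶠ? j) (ℕ.<-irrefl pj≡j)))
    (sym (𝟙-no (w ⟨$⟩ʳ j <ᶠ? j) (ℕ.<-irrefl (cong toℕ wj≡j))))
  where
  wj≡j : w ⟨$⟩ʳ j ≡ j
  wj≡j = sameCycle-fixed p (toℕ-injective pj≡j) (j~wj j)

aexc-PopT+cycGt1 : .{{_ : NonZero n}} {c w p : Perm n} → IsCoxeterElement n c → IsPiT c w p →
  aexc (PopT w p) + cycGt1 p ≡ aexc w
aexc-PopT+cycGt1 {c = c} {w} {p} c-cox p-is-π = begin
  aexc (PopT w p) + cycGt1 p
    ≡⟨ cong₂ _+_ (aexc-PopT w p) (trans (cycGt1≡aexc p-inc) (aexc≡sum-drops p)) ⟩
  sum (λ j → 𝟙[ w ⟨$⟩ʳ j <ᶠ? p ⟨$⟩ʳ j ]) + sum (λ j → 𝟙[ p ⟨$⟩ʳ j <ᶠ? j ])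
    ≡⟨ sym (∑-distrib-+ (λ j → 𝟙[ w ⟨$⟩ʳ j <ᶠ? p ⟨$⟩ʳ j ]) (λ j → 𝟙[ p ⟨$⟩ʳ j <ᶠ? j ])) ⟩
  sum (λ j → 𝟙[ w ⟨$⟩ʳ j <ᶠ? p ⟨$⟩ʳ j ] + 𝟙[ p ⟨$⟩ʳ j <ᶠ? j ])
    ≡⟨ sum-cong-≗ (drop-split {w = w} p-inc (π-sameCycle {c = c} {w} {p} p-is-π) (π-fixes {c = c} {w} {p} p-is-π)) ⟩
  sum (λ j → 𝟙[ w ⟨$⟩ʳ j <ᶠ? j ])
    ≡⟨ sym (aexc≡sum-drops w) ⟩
  aexc w ∎
  where
  open ≡-Reasoning
  p-inc : CyclicallyIncreasing p
  p-inc = ≤T-cyclicallyIncreasing {p = p} {c} (proj₂ (proj₁ p-is-π)) (coxeter-cyclicallyIncreasing {c = c} c-cox)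

-- The Coxeter element (1 2 ⋯ n)

module _ {m : ℕ} where

  private
    last : Fin (suc m)
    last = Fin.fromℕ m

    ≤last : (x : Fin (suc m)) → toℕ x ≤ m
    ≤last x = ℕ.≤-pred (toℕ<n x)

    last≮ : (x : Fin (suc m)) → ¬ toℕ last < toℕ x
    last≮ x last<x = ℕ.<⇒≱ last<x (subst (toℕ x ≤_) (sym (toℕ-fromℕ m)) (≤last x))

    <m-if-≢last : (i : Fin (suc m)) → i ≢ last → toℕ i < m
    <m-if-≢last i i≢last = ℕ.≤∧≢⇒< (≤last i) (λ i≡m → i≢last (toℕ-injective (trans i≡m (sym (toℕ-fromℕ m)))))

    successor : (i : Fin (suc m)) → toℕ i < m → suc (toℕ i) % suc m ≡ suc (toℕ i)
    successor i i<m = m<n⇒m%n≡m (s≤s i<m)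

    successor-last : suc (toℕ last) % suc m ≡ 0
    successor-last = trans (cong (λ k → suc k % suc m) (toℕ-fromℕ m)) (n%n≡0 (suc m))

  aexc-coxeter⁻¹ : {c : Perm (suc m)} → IsCoxeterElement (suc m) c → aexc (c ⁻¹) ≡ m
  aexc-coxeter⁻¹ {c} c-cox = ℕ.+-cancelʳ-≡ 1 _ _ (begin
    aexc (c ⁻¹) + 1
      ≡⟨ cong₂ _+_ (count≡sum (λ i → i <ᶠ? c ⟨$⟩ʳ i)) (sym (sum-𝟙-≟ last)) ⟩
    sum (λ i → 𝟙[ i <ᶠ? c ⟨$⟩ʳ i ]) + sum (λ i → 𝟙[ i ≟ last ])
      ≡⟨ sym (∑-distrib-+ (λ i → 𝟙[ i <ᶠ? c ⟨$⟩ʳ i ]) (λ i → 𝟙[ i ≟ last ])) ⟩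
    sum (λ i → 𝟙[ i <ᶠ? c ⟨$⟩ʳ i ] + 𝟙[ i ≟ last ])
      ≡⟨ sum-cong-≗ pointwise ⟩
    sum {suc m} (λ _ → 1)
      ≡⟨ sum-const-1 (suc m) ⟩
    suc m
      ≡⟨ ℕ.+-comm 1 m ⟩
    m + 1 ∎)
    where
    open ≡-Reasoning
    pointwise : ∀ i → 𝟙[ i <ᶠ? c ⟨$⟩ʳ i ] + 𝟙[ i ≟ last ] ≡ 1
    pointwise i with i ≟ last
    ... | yes refl = cong (_+ 1) (𝟙-no (last <ᶠ? c ⟨$⟩ʳ last) (last≮ (c ⟨$⟩ʳ last)))
    ... | no i≢last = trans (ℕ.+-identityʳ _) (𝟙-yes (i <ᶠ? c ⟨$⟩ʳ i)
      (subst (toℕ i <_) (sym (trans (c-cox i) (successor i (<m-if-≢last i i≢last)))) (ℕ.n<1+n (toℕ i))))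

  -- Descending from m − 1: u i > i and every value above i + 1 is already taken, so u i = i + 1.
  module _ {u : Perm (suc m)} (ascending : ∀ i → toℕ i < m → toℕ i < toℕ (u ⟨$⟩ʳ i)) where

    private
      taken : ∀ {i} v → toℕ (u ⟨$⟩ʳ i) ≡ suc v → v < m
      taken {i} v eq = ℕ.≤-pred (subst (_< suc m) eq (toℕ<n (u ⟨$⟩ʳ i)))

      successor-of : ∀ t i → m ≤ t + toℕ i → toℕ i < m → toℕ (u ⟨$⟩ʳ i) ≡ suc (toℕ i)
      successor-of zero    i m≤i i<m = ⊥-elim (ℕ.<⇒≱ i<m m≤i)
      successor-of (suc t) i m≤1+t+i i<m with toℕ (u ⟨$⟩ʳ i) in eq
      ... | zero  = ⊥-elim (ℕ.n≮0 (subst (toℕ i <_) eq (ascending i i<m)))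
      ... | suc v with toℕ i ℕ.≟ v
      ...   | yes i≡v = cong suc (sym i≡v)
      ...   | no i≢v  = ⊥-elim (i≢v (trans (cong toℕ i≡j) (toℕ-fromℕ< v<1+m)))
        where
        v<1+m : v < suc m
        v<1+m = ℕ.m<n⇒m<1+n (taken v eq)
        j : Fin (suc m)
        j = fromℕ< v<1+m
        i<j : toℕ i < toℕ j
        i<j = subst (toℕ i <_) (sym (toℕ-fromℕ< v<1+m)) (ℕ.≤∧≢⇒< (ℕ.≤-pred (subst (toℕ i <_) eq (ascending i i<m))) i≢v)
        uj≡1+v : toℕ (u ⟨$⟩ʳ j) ≡ suc v
        uj≡1+v = trans (successor-of t j (ℕ.≤-trans m≤1+t+i (subst (_≤ t + toℕ j) (ℕ.+-suc t (toℕ i)) (ℕ.+-monoʳ-≤ t i<j)))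
                                       (subst (_< m) (sym (toℕ-fromℕ< v<1+m)) (taken v eq)))
                       (cong suc (toℕ-fromℕ< v<1+m))
        i≡j : i ≡ j
        i≡j = ⟨$⟩ʳ-injective u (toℕ-injective (trans eq (sym uj≡1+v)))

      u-last≡0 : toℕ (u ⟨$⟩ʳ last) ≡ 0
      u-last≡0 with toℕ (u ⟨$⟩ʳ last) in eq
      ... | zero  = refl
      ... | suc v = ⊥-elim (ℕ.<-irrefl (sym (trans (sym (toℕ-fromℕ m)) (trans (cong toℕ last≡j) (toℕ-fromℕ< v<1+m)))) (taken v eq))
        where
        v<1+m : v < suc m
        v<1+m = ℕ.m<n⇒m<1+n (taken v eq)
        j : Fin (suc m)
        j = fromℕ< v<1+m
        uj≡1+v : toℕ (u ⟨$⟩ʳ j) ≡ suc v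
        uj≡1+v = trans (successor-of m j (ℕ.m≤m+n m _) (subst (_< m) (sym (toℕ-fromℕ< v<1+m)) (taken v eq)))
                       (cong suc (toℕ-fromℕ< v<1+m))
        last≡j : last ≡ j
        last≡j = ⟨$⟩ʳ-injective u (toℕ-injective (trans eq (sym uj≡1+v)))

    ascending⇒coxeter : IsCoxeterElement (suc m) u
    ascending⇒coxeter i with i ≟ last
    ... | no i≢last = trans (successor-of m i (ℕ.m≤m+n m _) (<m-if-≢last i i≢last))
                        (sym (successor i (<m-if-≢last i i≢last)))
    ... | yes refl = trans u-last≡0 (sym successor-last)

  aexc≤m∸1 : {c w : Perm (suc m)} → IsCoxeterElement (suc m) c → ¬ w ≈ c ⁻¹ → aexc w ≤ suc m ∸ 2
  aexc≤m∸1 {c} {w} c-cox w≉c⁻¹ with any? (λ i → ¬? (i ≟ last) ×-dec ¬? (i <ᶠ? w ⟨$⟩ˡ i))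
  ... | yes (i , i≢last , i≮w⁻¹i) = ℕ.m+n≤o⇒m≤o∸n (aexc w) (begin
    aexc w + 2
      ≡⟨ cong (_+ 2) (count≡sum (λ i → i <ᶠ? w ⟨$⟩ˡ i)) ⟩
    sum (λ i → 𝟙[ i <ᶠ? w ⟨$⟩ˡ i ]) + 2
      ≤⟨ sum-bits+2≤ (λ i → 𝟙≤1 (i <ᶠ? w ⟨$⟩ˡ i)) i≢last
           (𝟙-no (i <ᶠ? w ⟨$⟩ˡ i) i≮w⁻¹i) (𝟙-no (last <ᶠ? w ⟨$⟩ˡ last) (last≮ (w ⟨$⟩ˡ last))) ⟩
    suc m ∎)
    where open ℕ.≤-Reasoning
  ... | no none = ⊥-elim (w≉c⁻¹ (⁻¹-cong {u = w ⁻¹} {c} λ i →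
        toℕ-injective (trans (ascending⇒coxeter {u = w ⁻¹} ascending i) (sym (c-cox i)))))
    where
    ascending : ∀ i → toℕ i < m → toℕ i < toℕ (w ⟨$⟩ˡ i)
    ascending i i<m with i <ᶠ? w ⟨$⟩ˡ i
    ... | yes i<w⁻¹i = i<w⁻¹i
    ... | no i≮w⁻¹i = ⊥-elim (none (i , (λ i≡last → ℕ.<-irrefl (trans (cong toℕ i≡last) (toℕ-fromℕ m)) i<m) , i≮w⁻¹i))

theorem5p2 : (n : ℕ) → .{{_ : NonZero n}} → (c : Perm n) → IsCoxeterElement n c →
    (aexc (c ⁻¹) ≡ n ∸ 1)
    × (∀ (w : Perm n) → ¬ (w ≈ c ⁻¹) → aexc w ≤ n ∸ 2)
    × (∀ (w p : Perm n) → IsPiT c w p → aexc (PopT w p) + cycGt1 p ≡ aexc w)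
theorem5p2 (suc m) c c-cox =
  aexc-coxeter⁻¹ {c = c} c-cox , (λ w → aexc≤m∸1 {c = c} {w} c-cox) , λ w p → aexc-PopT+cycGt1 {c = c} {w} {p} c-cox
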